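{- Let $r_1,r_2$ be non-negative integers with $r:=r_1+r_2\geq 1$, and let $G:=\mathbb{Z}_{2^{\alpha_1}}\oplus\cdots\oplus\mathbb{Z}_{2^{\alpha_{r_1}}}\oplus\mathbb{Z}_2^{r_2}$ with integers $\alpha_1\geq\cdots\geq\alpha_{r_1}\geq 2$. Then $G$ has exactly $2^{r_1}-1$ subgroups of index $2$ of rank $r$, and exactly $2^r-2^{r_1}$ subgroups of index $2$ of rank $r-1$.
   Context: The rank of a finite abelian group is the minimum number of elements needed to generate it (so $G$ above has rank $r$). -}

module Defs where

open import Data.Nat using (ℕ; zero; suc; _+_; _*_; _∸_; _^_; _≤_)
open import Data.Nat.DivMod using (_mod_)
open import Data.Fin as Fin using (Fin; toℕ)
open import Data.Fin.Base using () renaming (_≤_ to _≤ᶠ_)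
import Data.List
open import Data.List using (List; []; _∷_; length; map; concatMap; filter; _++_; replicate)
open import Data.List.Relation.Unary.All using (All)
open import Data.List.Relation.Unary.Any using (Any)
open import Data.List.Relation.Unary.AllPairs using (AllPairs)
open import Data.Vec as Vec using (Vec; lookup; toList)
open import Data.Unit using (⊤; tt)
open import Data.Product using (Σ; ∃; _×_; _,_)
open import Data.Bool using (Bool; true; false; T)
import Data.Bool
open import Relation.Nullary using (¬_)
open import Relation.Binary.PropositionalEquality using (_≡_)

-- Cyclic groups Z_m on Fin m (for m = 0 the carrier is empty anyway)

addMod : ∀ {m} → Fin m → Fin m → Fin m
addMod {suc k} a b = (toℕ a + toℕ b) mod (suc k)

negMod : ∀ {m} → Fin m → Fin m
negMod {suc k} a = (suc k ∸ toℕ a) mod (suc k)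


Carrier : List ℕ → Set
Carrier []       = ⊤
Carrier (m ∷ ms) = Fin m × Carrier ms

_⊕_ : ∀ {ms} → Carrier ms → Carrier ms → Carrier ms
_⊕_ {[]}     tt       tt       = tt
_⊕_ {m ∷ ms} (a , x)  (b , y)  = addMod a b , (x ⊕ y)

⊖_ : ∀ {ms} → Carrier ms → Carrier ms
⊖_ {[]}     tt      = tt
⊖_ {m ∷ ms} (a , x) = negMod a , (⊖ x)

elements : (ms : List ℕ) → List (Carrier ms)
elements []       = tt ∷ []
elements (m ∷ ms) = concatMap (λ a → map (λ x → (a , x)) (elements ms)) (Data.List.allFin m)

moduli : ∀ {r₁} → Vec ℕ r₁ → ℕ → List ℕ
moduli α r₂ = map (2 ^_) (toList α) ++ replicate r₂ 2

module _ {ms : List ℕ} where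

  Subset : Set
  Subset = Carrier ms → Bool

  _∈ˢ_ : Carrier ms → Subset → Set
  x ∈ˢ H = H x ≡ true

  IsSubgroup : Subset → Set
  IsSubgroup H = (∃ λ x → x ∈ˢ H)
               × (∀ x y → x ∈ˢ H → y ∈ˢ H → (x ⊕ y) ∈ˢ H)
               × (∀ x → x ∈ˢ H → (⊖ x) ∈ˢ H)

  card : Subset → ℕ
  card H = length (filter (λ x → Data.Bool._≟_ (H x) true) (elements ms))

  HasIndex2 : Subset → Set
  HasIndex2 H = length (elements ms) ≡ 2 * card H

  _·_ : ℕ → Carrier ms → Carrier ms
  zero  · x = x ⊕ (⊖ x)
  suc n · x = x ⊕ (n · x)

  -- ℕ-linear combination Σ cᵢ gᵢ (the zero combination is 0 = x ⊕ ⊖ x)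
  comb : (gs : List (Carrier ms)) → Vec ℕ (length gs) → Carrier ms → Carrier ms
  comb []       Vec.[]       z = z
  comb (g ∷ gs) (c Vec.∷ cs) z = (c · g) ⊕ comb gs cs z

  Generates : List (Carrier ms) → Subset → Set
  Generates gs H = All (λ g → g ∈ˢ H) gs
                 × (∀ x → x ∈ˢ H → ∃ λ cs → ∃ λ z → comb gs cs (z ⊕ (⊖ z)) ≡ x)

  HasRank : Subset → ℕ → Set
  HasRank H k = (∃ λ gs → length gs ≡ k × Generates gs H)
              × (∀ gs → Generates gs H → k ≤ length gs)

  _≐_ : Subset → Subset → Set
  H ≐ K = ∀ x → H x ≡ K x

  Exactly : ℕ → (Subset → Set) → Set
  Exactly n P = ∃ λ (Hs : List Subset) →
      length Hs ≡ n
    × All P Hs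
    × AllPairs (λ H K → ¬ (H ≐ K)) Hs
    × (∀ H → P H → Any (H ≐_) Hs)

NonIncreasing : ∀ {n} → Vec ℕ n → Set
NonIncreasing {n} α = ∀ (i j : Fin n) → i ≤ᶠ j → lookup α j ≤ lookup α i

AllAtLeast2 : ∀ {n} → Vec ℕ n → Set
AllAtLeast2 {n} α = ∀ (i : Fin n) → 2 ≤ lookup α i

{-# OPTIONS --safe #-}

-- A subgroup H of index 2 is the kernel of the character 1 − 1_H to ℤ/2. Every character of
-- G = ℤ/m₁ ⊕ ⋯ ⊕ ℤ/m_r (all mᵢ even) is χ ε x = Σ_{εᵢ = 1} xᵢ mod 2 for a unique ε ∈ 𝔽₂^r, namely its values
-- on the unit vectors, so the subgroups of index 2 correspond to the nonzero ε.
-- Choose a pivot p with ε_p = 1. Then kernel ε is generated by the elements eᵢ + εᵢ e_p (i ≠ p) together with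
-- 2 e_p, which vanishes when m_p = 2. Conversely, a map from kernel ε onto 𝔽₂ᵏ that is additive bounds the rank
-- from below by k, since it sends any n generators to a spanning set of 𝔽₂ᵏ, whence 2ᵏ ≤ 2ⁿ. The parities of the
-- coordinates other than p give such a map onto 𝔽₂^{r−1}; when 4 ∣ m_p, adding the bit ⌊Σ_{εᵢ = 1} xᵢ / 2⌋ mod 2
-- gives one onto 𝔽₂^r. So kernel ε has rank r if ε is nonzero on the coordinates ℤ/2^{αⱼ} (2^{r₁} − 1 choices),
-- and rank r − 1 otherwise (2^{r₁} (2^{r₂} − 1) choices).

module Submission where

open import Defs

open import Data.Bool as Bool using (Bool; true; false; not; _xor_; _∧_; if_then_else_)
open import Data.Bool.Properties
  using (not-involutive; not-injective; not-distribˡ-xor; not-¬; ¬-not; xor-identityʳ; xor-same; xor-assoc; xor-comm; true-xor;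
         ∧-comm; ∧-zeroʳ; ∧-identityʳ)
open import Data.Fin as Fin using (Fin; toℕ; fromℕ<)
open import Data.Fin.Permutation using (Permutation′; permutation)
open import Data.Fin.Properties using (toℕ-fromℕ<; toℕ-injective; toℕ<n; 2↔Bool; injective⇒≤)
open import Data.List using (List; []; _∷_; replicate; length; map; filter; concatMap; _++_; allFin; tabulate; take; drop)
open import Data.List.Membership.Propositional using (_∈_)
open import Data.List.Membership.Propositional.Properties using (∈-map⁺; ∈-map⁻; ∈-++⁺ˡ; ∈-++⁺ʳ; ∈-++⁻; ∈-allFin; ∈-length)
open import Data.List.Properties
  using (length-++; length-map; length-replicate; length-take; length-drop; take++drop≡id; ++-cancelʳ; ++-identityʳ; ∷-injectiveʳ;
         filter-++; filter-all; map-tabulate; map-cong; map-id-local)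
open import Data.List.Relation.Unary.All as All using (All; []; _∷_)
import Data.List.Relation.Unary.All.Properties as All
open import Data.List.Relation.Unary.AllPairs as AllPairs using (AllPairs; []; _∷_)
import Data.List.Relation.Unary.AllPairs.Properties as AllPairs
open import Data.List.Relation.Unary.Any as Any using (Any; here; there; any?)
import Data.List.Relation.Unary.Any.Properties as Any
open import Data.List.Relation.Unary.Unique.Propositional using (Unique)
import Data.List.Relation.Unary.Unique.Propositional.Properties as Unique
open import Data.Nat using (ℕ; zero; suc; pred; _+_; _*_; _∸_; _^_; _≤_; _<_; _⊓_; NonZero; _%_; _/_; z≤n; s≤s)
open import Data.Nat.DivMod using (%-distribˡ-+; m%n%n≡m%n; n%n≡0; m<n⇒m%n≡m; m∣n⇒o%n%m≡o%m; m≡m%n+[m/n]*n)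
open import Data.Nat.Divisibility using (_∣_; divides; ∣⇒≤)
open import Data.Nat.ListAction using (sum)
open import Data.Nat.Properties
open import Algebra.Properties.CommutativeMonoid.Sum +-0-commutativeMonoid using (∑-permute; sum-cong-≗) renaming (sum to ∑)
open import Algebra.Properties.CommutativeSemigroup +-commutativeSemigroup using (interchange)
open import Data.Product using (∃; ∃₂; _×_; _,_; proj₁; proj₂)
open import Data.Sum using (_⊎_; inj₁; inj₂; fromInj₁)
open import Data.Unit using (⊤; tt)
open import Data.Vec as Vec using (Vec; []; _∷_; zipWith; toList)
open import Data.Vec.Properties using (length-toList; zipWith-identityʳ)
open import Data.Vec.Recursive using (Fin[m^n]↔Fin[m]^n; lift↔)
open import Data.Vec.Recursive.Properties using (↔Vec)
open import Function using (_∘_; case_of_; Inverse; _↔_)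
open import Function.Properties.Inverse using (↔-trans)
open import Relation.Binary.PropositionalEquality
open import Relation.Nullary using (¬_; Dec; yes; no; contradiction)
open import Relation.Nullary.Decidable using (decidable-stable)

open ≡-Reasoning

xor≡false⇒≡ : ∀ a b → a xor b ≡ false → a ≡ b
xor≡false⇒≡ true  true  _ = refl
xor≡false⇒≡ false false _ = refl

xor-cancelʳ : ∀ a b → (a xor b) xor b ≡ a
xor-cancelʳ a b = trans (xor-assoc a b b) (trans (cong (a xor_) (xor-same b)) (xor-identityʳ a))

odd : ℕ → Bool
odd zero    = false
odd (suc n) = not (odd n)

odd-+ : ∀ m n → odd (m + n) ≡ odd m xor odd n
odd-+ zero    n = refl
odd-+ (suc m) n = trans (cong not (odd-+ m n)) (not-distribˡ-xor (odd m) (odd n))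

odd-*2+ : ∀ q m → odd (q * 2 + m) ≡ odd m
odd-*2+ zero    m = refl
odd-*2+ (suc q) m = trans (not-involutive _) (odd-*2+ q m)

odd-%2 : ∀ n → odd (n % 2) ≡ odd n
odd-%2 n = begin
  odd (n % 2)             ≡⟨ odd-*2+ (n / 2) (n % 2) ⟨
  odd (n / 2 * 2 + n % 2) ≡⟨ cong odd (+-comm (n / 2 * 2) (n % 2)) ⟩
  odd (n % 2 + n / 2 * 2) ≡⟨ cong odd (m≡m%n+[m/n]*n n 2) ⟨
  odd n                   ∎

odd-cong-%2 : ∀ m n → m % 2 ≡ n % 2 → odd m ≡ odd n
odd-cong-%2 m n eq = trans (sym (odd-%2 m)) (trans (cong odd eq) (odd-%2 n))

odd-% : ∀ n d .{{_ : NonZero d}} → 2 ∣ d → odd (n % d) ≡ odd n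
odd-% n d 2∣d = odd-cong-%2 (n % d) n (m∣n⇒o%n%m≡o%m 2 d n 2∣d)

even⇒2∣ : ∀ n → odd n ≡ false → 2 ∣ n
even⇒2∣ zero          _      = divides 0 refl
even⇒2∣ (suc zero)    ()
even⇒2∣ (suc (suc n)) even-n with even⇒2∣ n (trans (sym (not-involutive (odd n))) even-n)
... | divides q refl = divides (suc q) refl

oddHalf : ℕ → Bool
oddHalf zero          = false
oddHalf (suc zero)    = false
oddHalf (suc (suc n)) = not (oddHalf n)

oddHalf-suc : ∀ n → oddHalf (suc n) ≡ oddHalf n xor odd n
oddHalf-suc zero          = refl
oddHalf-suc (suc zero)    = refl
oddHalf-suc (suc (suc n)) = begin
  not (oddHalf (suc n))                        ≡⟨ cong not (oddHalf-suc n) ⟩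
  not (oddHalf n xor odd n)                    ≡⟨ not-distribˡ-xor (oddHalf n) (odd n) ⟩
  not (oddHalf n) xor odd n                    ≡⟨ cong (not (oddHalf n) xor_) (not-involutive (odd n)) ⟨
  not (oddHalf n) xor not (not (odd n))        ∎

oddHalf-+ : ∀ m n → oddHalf (m + n) ≡ (oddHalf m xor oddHalf n) xor (odd m ∧ odd n)
oddHalf-+ zero          n = sym (xor-identityʳ (oddHalf n))
oddHalf-+ (suc zero)    n = oddHalf-suc n
oddHalf-+ (suc (suc m)) n = begin
  not (oddHalf (m + n))                                              ≡⟨ cong not (oddHalf-+ m n) ⟩
  not ((oddHalf m xor oddHalf n) xor (odd m ∧ odd n))                ≡⟨ not-distribˡ-xor (oddHalf m xor oddHalf n) (odd m ∧ odd n) ⟩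
  not (oddHalf m xor oddHalf n) xor (odd m ∧ odd n)                  ≡⟨ cong₂ _xor_ (not-distribˡ-xor (oddHalf m) (oddHalf n))
                                                                                    (cong (_∧ odd n) (sym (not-involutive (odd m)))) ⟩
  (not (oddHalf m) xor oddHalf n) xor (not (not (odd m)) ∧ odd n)    ∎

oddHalf-*4+ : ∀ q m → oddHalf (q * 4 + m) ≡ oddHalf m
oddHalf-*4+ zero    m = refl
oddHalf-*4+ (suc q) m = trans (not-involutive _) (oddHalf-*4+ q m)

oddHalf-cong-%4 : ∀ m n → m % 4 ≡ n % 4 → oddHalf m ≡ oddHalf n
oddHalf-cong-%4 m n eq = trans (sym (oddHalf-%4 m)) (trans (cong oddHalf eq) (oddHalf-%4 n))
  where
  oddHalf-%4 : ∀ n → oddHalf (n % 4) ≡ oddHalf n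
  oddHalf-%4 n = begin
    oddHalf (n % 4)             ≡⟨ oddHalf-*4+ (n / 4) (n % 4) ⟨
    oddHalf (n / 4 * 4 + n % 4) ≡⟨ cong oddHalf (+-comm (n / 4 * 4) (n % 4)) ⟩
    oddHalf (n % 4 + n / 4 * 4) ≡⟨ cong oddHalf (m≡m%n+[m/n]*n n 4) ⟨
    oddHalf n                   ∎

[m%d+n]%d≡[m+n]%d : ∀ m n d .{{_ : NonZero d}} → (m % d + n) % d ≡ (m + n) % d
[m%d+n]%d≡[m+n]%d m n d = begin
  (m % d + n) % d           ≡⟨ %-distribˡ-+ (m % d) n d ⟩
  (m % d % d + n % d) % d   ≡⟨ cong (λ t → (t + n % d) % d) (m%n%n≡m%n m d) ⟩
  (m % d + n % d) % d       ≡⟨ %-distribˡ-+ m n d ⟨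
  (m + n) % d               ∎

[m+n%d]%d≡[m+n]%d : ∀ m n d .{{_ : NonZero d}} → (m + n % d) % d ≡ (m + n) % d
[m+n%d]%d≡[m+n]%d m n d = begin
  (m + n % d) % d ≡⟨ cong (_% d) (+-comm m (n % d)) ⟩
  (n % d + m) % d ≡⟨ [m%d+n]%d≡[m+n]%d n m d ⟩
  (n + m) % d     ≡⟨ cong (_% d) (+-comm n m) ⟩
  (m + n) % d     ∎

%-cong-+ : ∀ {m m′ n n′} d .{{_ : NonZero d}} → m % d ≡ m′ % d → n % d ≡ n′ % d → (m + n) % d ≡ (m′ + n′) % d
%-cong-+ {m} {m′} {n} {n′} d m≡m′ n≡n′ = begin
  (m + n) % d             ≡⟨ %-distribˡ-+ m n d ⟩
  (m % d + n % d) % d     ≡⟨ cong₂ (λ s t → (s + t) % d) m≡m′ n≡n′ ⟩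
  (m′ % d + n′ % d) % d   ≡⟨ %-distribˡ-+ m′ n′ d ⟨
  (m′ + n′) % d           ∎

module _ {n : ℕ} where

  toℕ-addMod : (a b : Fin (suc n)) → toℕ (addMod a b) ≡ (toℕ a + toℕ b) % suc n
  toℕ-addMod a b = toℕ-fromℕ< _

  toℕ-negMod : (a : Fin (suc n)) → toℕ (negMod a) ≡ (suc n ∸ toℕ a) % suc n
  toℕ-negMod a = toℕ-fromℕ< _

  toℕ%≡toℕ : (a : Fin (suc n)) → toℕ a % suc n ≡ toℕ a
  toℕ%≡toℕ a = m<n⇒m%n≡m (toℕ<n a)

  addMod-comm : (a b : Fin (suc n)) → addMod a b ≡ addMod b a
  addMod-comm a b = toℕ-injective (begin
    toℕ (addMod a b)          ≡⟨ toℕ-addMod a b ⟩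
    (toℕ a + toℕ b) % suc n   ≡⟨ cong (_% suc n) (+-comm (toℕ a) (toℕ b)) ⟩
    (toℕ b + toℕ a) % suc n   ≡⟨ toℕ-addMod b a ⟨
    toℕ (addMod b a)          ∎)

  addMod-assoc : (a b c : Fin (suc n)) → addMod (addMod a b) c ≡ addMod a (addMod b c)
  addMod-assoc a b c = toℕ-injective (begin
    toℕ (addMod (addMod a b) c)                 ≡⟨ toℕ-addMod (addMod a b) c ⟩
    (toℕ (addMod a b) + toℕ c) % suc n          ≡⟨ cong (λ t → (t + toℕ c) % suc n) (toℕ-addMod a b) ⟩
    ((toℕ a + toℕ b) % suc n + toℕ c) % suc n   ≡⟨ [m%d+n]%d≡[m+n]%d (toℕ a + toℕ b) (toℕ c) (suc n) ⟩
    (toℕ a + toℕ b + toℕ c) % suc n             ≡⟨ cong (_% suc n) (+-assoc (toℕ a) (toℕ b) (toℕ c)) ⟩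
    (toℕ a + (toℕ b + toℕ c)) % suc n           ≡⟨ [m+n%d]%d≡[m+n]%d (toℕ a) (toℕ b + toℕ c) (suc n) ⟨
    (toℕ a + (toℕ b + toℕ c) % suc n) % suc n   ≡⟨ cong (λ t → (toℕ a + t) % suc n) (toℕ-addMod b c) ⟨
    (toℕ a + toℕ (addMod b c)) % suc n          ≡⟨ toℕ-addMod a (addMod b c) ⟨
    toℕ (addMod a (addMod b c))                 ∎)

  addMod-identityˡ : (a : Fin (suc n)) → addMod Fin.zero a ≡ a
  addMod-identityˡ a = toℕ-injective (trans (toℕ-addMod Fin.zero a) (toℕ%≡toℕ a))

  addMod-identityʳ : (a : Fin (suc n)) → addMod a Fin.zero ≡ a
  addMod-identityʳ a = trans (addMod-comm a Fin.zero) (addMod-identityˡ a)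

  addMod-inverseʳ : (a : Fin (suc n)) → addMod a (negMod a) ≡ Fin.zero
  addMod-inverseʳ a = toℕ-injective (begin
    toℕ (addMod a (negMod a))                 ≡⟨ toℕ-addMod a (negMod a) ⟩
    (toℕ a + toℕ (negMod a)) % suc n          ≡⟨ cong (λ t → (toℕ a + t) % suc n) (toℕ-negMod a) ⟩
    (toℕ a + (suc n ∸ toℕ a) % suc n) % suc n ≡⟨ [m+n%d]%d≡[m+n]%d (toℕ a) (suc n ∸ toℕ a) (suc n) ⟩
    (toℕ a + (suc n ∸ toℕ a)) % suc n         ≡⟨ cong (_% suc n) (m+[n∸m]≡n (<⇒≤ (toℕ<n a))) ⟩
    suc n % suc n                             ≡⟨ n%n≡0 (suc n) ⟩
    0                                         ∎)

  addMod-inverseˡ : (a : Fin (suc n)) → addMod (negMod a) a ≡ Fin.zero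
  addMod-inverseˡ a = trans (addMod-comm (negMod a) a) (addMod-inverseʳ a)

  addMod-cancelˡ : (a b : Fin (suc n)) → addMod a (addMod (negMod a) b) ≡ b
  addMod-cancelˡ a b = begin
    addMod a (addMod (negMod a) b) ≡⟨ addMod-assoc a (negMod a) b ⟨
    addMod (addMod a (negMod a)) b ≡⟨ cong (λ t → addMod t b) (addMod-inverseʳ a) ⟩
    addMod Fin.zero b              ≡⟨ addMod-identityˡ b ⟩
    b                              ∎

  negMod-cancelˡ : (a b : Fin (suc n)) → addMod (negMod a) (addMod a b) ≡ b
  negMod-cancelˡ a b = begin
    addMod (negMod a) (addMod a b) ≡⟨ addMod-assoc (negMod a) a b ⟨
    addMod (addMod (negMod a) a) b ≡⟨ cong (λ t → addMod t b) (addMod-inverseˡ a) ⟩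
    addMod Fin.zero b              ≡⟨ addMod-identityˡ b ⟩
    b                              ∎

Even⁺ : ℕ → Set
Even⁺ m = ∃ λ k → m ≡ 2 * suc k

EvenModuli : List ℕ → Set
EvenModuli = All Even⁺

0ᴳ : ∀ {ms} → EvenModuli ms → Carrier ms
0ᴳ []                 = tt
0ᴳ ((k , refl) ∷ ev)  = Fin.zero , 0ᴳ ev

⊕-comm : ∀ {ms} (x y : Carrier ms) → x ⊕ y ≡ y ⊕ x
⊕-comm {[]}         tt       tt       = refl
⊕-comm {suc _ ∷ _}  (a , x)  (b , y)  = cong₂ _,_ (addMod-comm a b) (⊕-comm x y)
⊕-comm {zero ∷ _}   (() , _) _

⊕-assoc : ∀ {ms} (x y z : Carrier ms) → (x ⊕ y) ⊕ z ≡ x ⊕ (y ⊕ z)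
⊕-assoc {[]}         tt       tt       tt       = refl
⊕-assoc {suc _ ∷ _}  (a , x)  (b , y)  (c , z)  = cong₂ _,_ (addMod-assoc a b c) (⊕-assoc x y z)
⊕-assoc {zero ∷ _}   (() , _) _ _

⊕-identityˡ : ∀ {ms} (ev : EvenModuli ms) (x : Carrier ms) → 0ᴳ ev ⊕ x ≡ x
⊕-identityˡ []                tt      = refl
⊕-identityˡ ((k , refl) ∷ ev) (a , x) = cong₂ _,_ (addMod-identityˡ a) (⊕-identityˡ ev x)

⊕-identityʳ : ∀ {ms} (ev : EvenModuli ms) (x : Carrier ms) → x ⊕ 0ᴳ ev ≡ x
⊕-identityʳ ev x = trans (⊕-comm x (0ᴳ ev)) (⊕-identityˡ ev x)

⊕-inverseʳ : ∀ {ms} (ev : EvenModuli ms) (x : Carrier ms) → x ⊕ (⊖ x) ≡ 0ᴳ ev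
⊕-inverseʳ []                tt      = refl
⊕-inverseʳ ((k , refl) ∷ ev) (a , x) = cong₂ _,_ (addMod-inverseʳ a) (⊕-inverseʳ ev x)

⊕-cancelʳ : ∀ {ms} (ev : EvenModuli ms) (x y : Carrier ms) → (x ⊕ y) ⊕ (⊖ y) ≡ x
⊕-cancelʳ ev x y = begin
  (x ⊕ y) ⊕ (⊖ y) ≡⟨ ⊕-assoc x y (⊖ y) ⟩
  x ⊕ (y ⊕ (⊖ y)) ≡⟨ cong (x ⊕_) (⊕-inverseʳ ev y) ⟩
  x ⊕ 0ᴳ ev       ≡⟨ ⊕-identityʳ ev x ⟩
  x               ∎

⊕-cancelˡ : ∀ {ms} (ev : EvenModuli ms) (x y : Carrier ms) → x ⊕ ((⊖ x) ⊕ y) ≡ y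
⊕-cancelˡ ev x y = begin
  x ⊕ ((⊖ x) ⊕ y) ≡⟨ ⊕-assoc x (⊖ x) y ⟨
  (x ⊕ (⊖ x)) ⊕ y ≡⟨ cong (_⊕ y) (⊕-inverseʳ ev x) ⟩
  0ᴳ ev ⊕ y       ≡⟨ ⊕-identityˡ ev y ⟩
  y               ∎

⊖-cancelˡ : ∀ {ms} (ev : EvenModuli ms) (x y : Carrier ms) → (⊖ x) ⊕ (x ⊕ y) ≡ y
⊖-cancelˡ ev x y = begin
  (⊖ x) ⊕ (x ⊕ y) ≡⟨ ⊕-assoc (⊖ x) x y ⟨
  ((⊖ x) ⊕ x) ⊕ y ≡⟨ cong (_⊕ y) (trans (⊕-comm (⊖ x) x) (⊕-inverseʳ ev x)) ⟩
  0ᴳ ev ⊕ y       ≡⟨ ⊕-identityˡ ev y ⟩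
  y               ∎

·-zeroʳ : ∀ {ms} (ev : EvenModuli ms) c → c · 0ᴳ ev ≡ 0ᴳ ev
·-zeroʳ ev zero    = ⊕-inverseʳ ev (0ᴳ ev)
·-zeroʳ ev (suc c) = trans (cong (0ᴳ ev ⊕_) (·-zeroʳ ev c)) (⊕-identityˡ ev (0ᴳ ev))

proj₂-· : ∀ {m ms} c (a : Fin m) (x : Carrier ms) → proj₂ (c · (a , x)) ≡ c · x
proj₂-· zero    a x = refl
proj₂-· (suc c) a x = cong (x ⊕_) (proj₂-· c a x)

toℕ-proj₁-· : ∀ {n ms} c (a : Fin (suc n)) (x : Carrier ms) → toℕ (proj₁ (c · (a , x))) ≡ (c * toℕ a) % suc n
toℕ-proj₁-· zero    a x = cong toℕ (addMod-inverseʳ a)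
toℕ-proj₁-· {n} (suc c) a x = begin
  toℕ (addMod a (proj₁ (c · (a , x))))           ≡⟨ toℕ-addMod a _ ⟩
  (toℕ a + toℕ (proj₁ (c · (a , x)))) % suc n    ≡⟨ cong (λ t → (toℕ a + t) % suc n) (toℕ-proj₁-· c a x) ⟩
  (toℕ a + (c * toℕ a) % suc n) % suc n          ≡⟨ [m+n%d]%d≡[m+n]%d (toℕ a) (c * toℕ a) (suc n) ⟩
  (toℕ a + c * toℕ a) % suc n                    ∎

IsHomomorphism : ∀ {ms ns} → (Carrier ms → Carrier ns) → Set
IsHomomorphism f = ∀ x y → f (x ⊕ y) ≡ f x ⊕ f y

homomorphism-· : ∀ {ms ns} (ev : EvenModuli ms) (ev′ : EvenModuli ns) {f : Carrier ms → Carrier ns} →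
  IsHomomorphism f → f (0ᴳ ev) ≡ 0ᴳ ev′ → ∀ c x → f (c · x) ≡ c · f x
homomorphism-· ev ev′ {f} homo f0 zero    x = trans (cong f (⊕-inverseʳ ev x)) (trans f0 (sym (⊕-inverseʳ ev′ (f x))))
homomorphism-· ev ev′ {f} homo f0 (suc c) x = trans (homo x (c · x)) (cong (f x ⊕_) (homomorphism-· ev ev′ homo f0 c x))

1<2*suc : ∀ k → 1 < 2 * suc k
1<2*suc k = *-monoʳ-≤ 2 (s≤s z≤n)

1ᶠ : ∀ k → Fin (2 * suc k)
1ᶠ k = fromℕ< (1<2*suc k)

toℕ-1ᶠ : ∀ k → toℕ (1ᶠ k) ≡ 1
toℕ-1ᶠ k = toℕ-fromℕ< (1<2*suc k)

2∣2*suc : ∀ k → 2 ∣ 2 * suc k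
2∣2*suc k = divides (suc k) (*-comm 2 (suc k))

proj₁-·-1ᶠ : ∀ {k ms} (a : Fin (2 * suc k)) (x : Carrier ms) → proj₁ (toℕ a · (1ᶠ k , x)) ≡ a
proj₁-·-1ᶠ {k} a x = toℕ-injective (begin
  toℕ (proj₁ (toℕ a · (1ᶠ k , x)))      ≡⟨ toℕ-proj₁-· (toℕ a) (1ᶠ k) x ⟩
  (toℕ a * toℕ (1ᶠ k)) % (2 * suc k)    ≡⟨ cong (λ t → (toℕ a * t) % (2 * suc k)) (toℕ-1ᶠ k) ⟩
  (toℕ a * 1) % (2 * suc k)             ≡⟨ cong (_% (2 * suc k)) (*-identityʳ (toℕ a)) ⟩
  toℕ a % (2 * suc k)                   ≡⟨ toℕ%≡toℕ a ⟩
  toℕ a                                 ∎)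

·-1ᶠ : ∀ {k ms} (ev : EvenModuli ms) (a : Fin (2 * suc k)) → toℕ a · (1ᶠ k , 0ᴳ ev) ≡ (a , 0ᴳ ev)
·-1ᶠ {k} ev a = cong₂ _,_ (proj₁-·-1ᶠ a (0ᴳ ev)) (trans (proj₂-· (toℕ a) (1ᶠ k) (0ᴳ ev)) (·-zeroʳ ev (toℕ a)))

pad : ∀ {n ms} → Carrier ms → Carrier (suc n ∷ ms)
pad x = Fin.zero , x

pad-homo : ∀ {n ms} → IsHomomorphism (pad {n} {ms})
pad-homo x y = cong (_, x ⊕ y) (sym (addMod-identityˡ Fin.zero))

odd-addMod : ∀ k (a b : Fin (2 * suc k)) → odd (toℕ (addMod a b)) ≡ odd (toℕ a) xor odd (toℕ b)
odd-addMod k a b = begin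
  odd (toℕ (addMod a b))                ≡⟨ cong odd (toℕ-addMod a b) ⟩
  odd ((toℕ a + toℕ b) % (2 * suc k))   ≡⟨ odd-% (toℕ a + toℕ b) (2 * suc k) (2∣2*suc k) ⟩
  odd (toℕ a + toℕ b)                   ≡⟨ odd-+ (toℕ a) (toℕ b) ⟩
  odd (toℕ a) xor odd (toℕ b)           ∎

bitᶠ : ∀ k → Bool → Fin (2 * suc k)
bitᶠ k true  = 1ᶠ k
bitᶠ k false = Fin.zero

odd-bitᶠ : ∀ k b → odd (toℕ (bitᶠ k b)) ≡ b
odd-bitᶠ k true  = cong odd (toℕ-1ᶠ k)
odd-bitᶠ k false = refl

odd-·-bitᶠ : ∀ k c e → odd ((c * toℕ (bitᶠ k e)) % (2 * suc k)) ≡ e ∧ odd c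
odd-·-bitᶠ k c e = trans (odd-% (c * toℕ (bitᶠ k e)) (2 * suc k) (2∣2*suc k)) (odd-* e)
  where
  odd-* : ∀ e → odd (c * toℕ (bitᶠ k e)) ≡ e ∧ odd c
  odd-* true  = cong odd (trans (cong (c *_) (toℕ-1ᶠ k)) (*-identityʳ c))
  odd-* false = cong odd (*-zeroʳ c)

2<2*suc : ∀ k → 4 ∣ 2 * suc k → 2 < 2 * suc k
2<2*suc k 4∣M = ≤-trans (s≤s (s≤s (s≤s z≤n))) (∣⇒≤ 4∣M)

2ᶠ : ∀ k → 4 ∣ 2 * suc k → Fin (2 * suc k)
2ᶠ k 4∣M = fromℕ< (2<2*suc k 4∣M)

toℕ-2ᶠ : ∀ k 4∣M → toℕ (2ᶠ k 4∣M) ≡ 2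
toℕ-2ᶠ k 4∣M = toℕ-fromℕ< (2<2*suc k 4∣M)

·-2ᶠ : ∀ {k ms} (ev : EvenModuli ms) 4∣M (d : Fin (2 * suc k)) q → toℕ d ≡ q * 2 → q · (2ᶠ k 4∣M , 0ᴳ ev) ≡ (d , 0ᴳ ev)
·-2ᶠ {k} ev 4∣M d q d≡2q = cong₂ _,_ (toℕ-injective (begin
  toℕ (proj₁ (q · (2ᶠ k 4∣M , 0ᴳ ev)))  ≡⟨ toℕ-proj₁-· q (2ᶠ k 4∣M) (0ᴳ ev) ⟩
  (q * toℕ (2ᶠ k 4∣M)) % (2 * suc k)    ≡⟨ cong (λ t → (q * t) % (2 * suc k)) (toℕ-2ᶠ k 4∣M) ⟩
  (q * 2) % (2 * suc k)                 ≡⟨ cong (_% (2 * suc k)) d≡2q ⟨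
  toℕ d % (2 * suc k)                   ≡⟨ toℕ%≡toℕ d ⟩
  toℕ d                                 ∎))
  (trans (proj₂-· q (2ᶠ k 4∣M) (0ᴳ ev)) (·-zeroʳ ev q))

padSecond : ∀ {n} k {ms} → Carrier (suc n ∷ ms) → Carrier (suc n ∷ 2 * suc k ∷ ms)
padSecond k (a , y) = a , pad y

padSecond-homo : ∀ {n} k {ms} → IsHomomorphism (padSecond {n} k {ms})
padSecond-homo k (a , x) (b , y) = cong (addMod a b ,_) (pad-homo x y)

count : {A : Set} → (A → Bool) → List A → ℕ
count f xs = length (filter (λ x → f x Bool.≟ true) xs)

module _ {A : Set} where

  count-cong : {f g : A → Bool} (xs : List A) → (∀ x → f x ≡ g x) → count f xs ≡ count g xs
  count-cong                 []       f≗g = refl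
  count-cong {f = f} {g = g} (x ∷ xs) f≗g with f x | g x | f≗g x
  ... | true  | .true  | refl = cong suc (count-cong xs f≗g)
  ... | false | .false | refl = count-cong xs f≗g

  count+count-not : (f : A → Bool) (xs : List A) → count f xs + count (not ∘ f) xs ≡ length xs
  count+count-not f []       = refl
  count+count-not f (x ∷ xs) with f x
  ... | true  = cong suc (count+count-not f xs)
  ... | false = trans (+-suc _ _) (cong suc (count+count-not f xs))

  count-++ : (f : A → Bool) (xs ys : List A) → count f (xs ++ ys) ≡ count f xs + count f ys
  count-++ f xs ys = trans (cong length (filter-++ _ xs ys)) (length-++ (filter _ xs))

  count-map : {B : Set} (f : A → Bool) (h : B → A) (xs : List B) → count f (map h xs) ≡ count (f ∘ h) xs
  count-map f h []       = refl
  count-map f h (x ∷ xs) with f (h x)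
  ... | true  = cong suc (count-map f h xs)
  ... | false = count-map f h xs

  count-concatMap : {B : Set} (f : A → Bool) (h : B → List A) (xs : List B) →
    count f (concatMap h xs) ≡ sum (map (count f ∘ h) xs)
  count-concatMap f h []       = refl
  count-concatMap f h (x ∷ xs) = trans (count-++ f (h x) (concatMap h xs)) (cong (count f (h x) +_) (count-concatMap f h xs))

  count-mono : (f g : A → Bool) → (∀ x → f x ≡ true → g x ≡ true) → (xs : List A) → count f xs ≤ count g xs
  count-mono f g f⊆g []       = z≤n
  count-mono f g f⊆g (x ∷ xs) with f x | g x | f⊆g x
  ... | true  | true  | _  = s≤s (count-mono f g f⊆g xs)
  ... | true  | false | fx⇒gx with () ← fx⇒gx refl
  ... | false | true  | _  = m≤n⇒m≤1+n (count-mono f g f⊆g xs)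
  ... | false | false | _  = count-mono f g f⊆g xs

  count-≡⇒⊇ : (f g : A → Bool) → (∀ x → f x ≡ true → g x ≡ true) → (xs : List A) →
    count f xs ≡ count g xs → ∀ {x} → x ∈ xs → g x ≡ true → f x ≡ true
  count-≡⇒⊇ f g f⊆g (y ∷ xs) eq {x} (here refl) gx with f x | g x | f⊆g x
  ... | true  | _     | _ = refl
  ... | false | true  | _ = contradiction eq (<⇒≢ (s≤s (count-mono f g f⊆g xs)))
  ... | false | false | _ = gx
  count-≡⇒⊇ f g f⊆g (y ∷ xs) eq (there x∈xs) gx with f y | g y | f⊆g y
  ... | true  | true  | _  = count-≡⇒⊇ f g f⊆g xs (suc-injective eq) x∈xs gx
  ... | true  | false | fy⇒gy with () ← fy⇒gy refl
  ... | false | true  | _  = contradiction eq (<⇒≢ (s≤s (count-mono f g f⊆g xs)))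
  ... | false | false | _  = count-≡⇒⊇ f g f⊆g xs eq x∈xs gx

∈-elements : ∀ {ms} (x : Carrier ms) → x ∈ elements ms
∈-elements {[]}     tt      = here refl
∈-elements {m ∷ ms} (a , x) = ∈-concatMap (∈-allFin a)
  where
  ∈-concatMap : ∀ {as : List (Fin m)} → a ∈ as → (a , x) ∈ concatMap (λ b → map (b ,_) (elements ms)) as
  ∈-concatMap (here refl)         = ∈-++⁺ˡ (∈-map⁺ (a ,_) (∈-elements x))
  ∈-concatMap {b ∷ _} (there a∈as) = ∈-++⁺ʳ (map (b ,_) (elements ms)) (∈-concatMap a∈as)

sum-map-allFin : ∀ {n} (h : Fin n → ℕ) → sum (map h (allFin n)) ≡ ∑ h
sum-map-allFin {n} h = trans (cong sum (map-tabulate (λ i → i) h)) (sum-tabulate h)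
  where
  sum-tabulate : ∀ {n} (h : Fin n → ℕ) → sum (tabulate h) ≡ ∑ h
  sum-tabulate {zero}  h = refl
  sum-tabulate {suc n} h = cong (h Fin.zero +_) (sum-tabulate (h ∘ Fin.suc))

count-elements-∷ : ∀ {m ms} (f : Carrier (m ∷ ms) → Bool) →
  count f (elements (m ∷ ms)) ≡ ∑ (λ a → count (λ x → f (a , x)) (elements ms))
count-elements-∷ {m} {ms} f = begin
  count f (elements (m ∷ ms))                                     ≡⟨ count-concatMap f _ (allFin m) ⟩
  sum (map (λ a → count f (map (a ,_) (elements ms))) (allFin m)) ≡⟨ cong sum (map-cong (λ a → count-map f (a ,_) (elements ms)) (allFin m)) ⟩
  sum (map (λ a → count (λ x → f (a , x)) (elements ms)) (allFin m)) ≡⟨ sum-map-allFin (λ a → count (λ x → f (a , x)) (elements ms)) ⟩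
  ∑ (λ a → count (λ x → f (a , x)) (elements ms))                 ∎

rotation : ∀ {n} → Fin (suc n) → Permutation′ (suc n)
rotation a = permutation (addMod a) (addMod (negMod a)) (addMod-cancelˡ a) (negMod-cancelˡ a)

count-translate : ∀ {ms} (f : Carrier ms → Bool) (x : Carrier ms) →
  count (λ y → f (x ⊕ y)) (elements ms) ≡ count f (elements ms)
count-translate {[]}        f tt       = refl
count-translate {zero ∷ _}  f (() , _)
count-translate {suc n ∷ ms} f (a , x) = begin
  count (λ y → f ((a , x) ⊕ y)) (elements (suc n ∷ ms))         ≡⟨ count-elements-∷ (λ y → f ((a , x) ⊕ y)) ⟩
  ∑ (λ b → count (λ y → f (addMod a b , x ⊕ y)) (elements ms))  ≡⟨ sum-cong-≗ (λ b → count-translate (λ y → f (addMod a b , y)) x) ⟩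
  ∑ (λ b → g (addMod a b))                                      ≡⟨ ∑-permute g (rotation a) ⟨
  ∑ g                                                           ≡⟨ count-elements-∷ f ⟨
  count f (elements (suc n ∷ ms))                               ∎
  where
  g : Fin (suc n) → ℕ
  g b = count (λ y → f (b , y)) (elements ms)

-- Characters to ℤ/2 and subgroups of index 2

IsCharacter : ∀ {ms} → (Carrier ms → Bool) → Set
IsCharacter f = ∀ x y → f (x ⊕ y) ≡ f x xor f y

ker : ∀ {ms} → (Carrier ms → Bool) → Subset {ms}
ker f = not ∘ f

module _ {ms} (ev : EvenModuli ms) (f : Carrier ms → Bool) (homo : IsCharacter f) where

  character-0 : f (0ᴳ ev) ≡ false
  character-0 = begin
    f (0ᴳ ev)               ≡⟨ cong f (⊕-identityˡ ev (0ᴳ ev)) ⟨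
    f (0ᴳ ev ⊕ 0ᴳ ev)       ≡⟨ homo (0ᴳ ev) (0ᴳ ev) ⟩
    f (0ᴳ ev) xor f (0ᴳ ev) ≡⟨ xor-same (f (0ᴳ ev)) ⟩
    false                   ∎

  character-⊖ : ∀ x → f (⊖ x) ≡ f x
  character-⊖ x = sym (xor≡false⇒≡ (f x) (f (⊖ x)) (begin
    f x xor f (⊖ x) ≡⟨ homo x (⊖ x) ⟨
    f (x ⊕ (⊖ x))   ≡⟨ cong f (⊕-inverseʳ ev x) ⟩
    f (0ᴳ ev)       ≡⟨ character-0 ⟩
    false           ∎))

  character-· : ∀ c x → f (c · x) ≡ odd c ∧ f x
  character-· zero    x = trans (cong f (⊕-inverseʳ ev x)) character-0
  character-· (suc c) x = begin
    f (x ⊕ (c · x))           ≡⟨ homo x (c · x) ⟩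
    f x xor f (c · x)         ≡⟨ cong (f x xor_) (character-· c x) ⟩
    f x xor (odd c ∧ f x)     ≡⟨ xor-∧ (odd c) (f x) ⟩
    not (odd c) ∧ f x         ∎
    where
    xor-∧ : ∀ a b → b xor (a ∧ b) ≡ not a ∧ b
    xor-∧ true  b = xor-same b
    xor-∧ false b = xor-identityʳ b

  ker-isSubgroup : IsSubgroup (ker f)
  ker-isSubgroup = (0ᴳ ev , cong not character-0) , closed , closed-⊖
    where
    closed : ∀ x y → x ∈ˢ ker f → y ∈ˢ ker f → (x ⊕ y) ∈ˢ ker f
    closed x y fx fy = cong not (trans (homo x y) (cong₂ _xor_ (not-injective fx) (not-injective fy)))
    closed-⊖ : ∀ x → x ∈ˢ ker f → (⊖ x) ∈ˢ ker f
    closed-⊖ x fx = trans (cong not (character-⊖ x)) fx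

  ker-hasIndex2 : ∀ e → f e ≡ true → HasIndex2 (ker f)
  ker-hasIndex2 e fe = begin
    length (elements ms)                   ≡⟨ count+count-not (ker f) (elements ms) ⟨
    |K| + count (not ∘ ker f) (elements ms) ≡⟨ cong (|K| +_) complement ⟨
    |K| + |K|                              ≡⟨ cong (|K| +_) (+-identityʳ |K|) ⟨
    2 * |K|                                ∎
    where
    |K| = count (ker f) (elements ms)
    swap : ∀ y → ker f (e ⊕ y) ≡ not (ker f y)
    swap y = cong not (trans (homo e y) (trans (cong (_xor f y) fe) (true-xor (f y))))
    complement : |K| ≡ count (not ∘ ker f) (elements ms)
    complement = trans (sym (count-translate (ker f) e)) (count-cong (elements ms) swap)

pairing : ∀ {ms} → List Bool → Carrier ms → ℕ
pairing {[]}    _           _       = 0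
pairing {_ ∷ _} []          _       = 0
pairing {_ ∷ _} (true ∷ ε)  (a , x) = toℕ a + pairing ε x
pairing {_ ∷ _} (false ∷ ε) (a , x) = pairing ε x

DividesSelected : ℕ → List Bool → List ℕ → Set
DividesSelected d _           []       = ⊤
DividesSelected d []          (_ ∷ _)  = ⊤
DividesSelected d (true ∷ ε)  (m ∷ ms) = d ∣ m × DividesSelected d ε ms
DividesSelected d (false ∷ ε) (m ∷ ms) = DividesSelected d ε ms

pairing-homo : ∀ {ms} d .{{_ : NonZero d}} (ε : List Bool) → DividesSelected d ε ms → (x y : Carrier ms) →
  pairing ε (x ⊕ y) % d ≡ (pairing ε x + pairing ε y) % d
pairing-homo {[]}        d ε           _           x        y       = refl
pairing-homo {_ ∷ _}     d []          _           x        y       = refl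
pairing-homo {zero ∷ _}  d (_ ∷ _)     _           (() , _) _
pairing-homo {suc n ∷ _} d (false ∷ ε) d∣          (a , x)  (b , y) = pairing-homo d ε d∣ x y
pairing-homo {suc n ∷ _} d (true ∷ ε)  (d∣m , d∣)  (a , x)  (b , y) = begin
  (toℕ (addMod a b) + pairing ε (x ⊕ y)) % d                 ≡⟨ %-cong-+ d toℕ-addMod-% (pairing-homo d ε d∣ x y) ⟩
  ((toℕ a + toℕ b) + (pairing ε x + pairing ε y)) % d        ≡⟨ cong (_% d) (interchange (toℕ a) (toℕ b) (pairing ε x) (pairing ε y)) ⟩
  ((toℕ a + pairing ε x) + (toℕ b + pairing ε y)) % d        ∎
  where
  toℕ-addMod-% : toℕ (addMod a b) % d ≡ (toℕ a + toℕ b) % d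
  toℕ-addMod-% = trans (cong (_% d) (toℕ-addMod a b)) (m∣n⇒o%n%m≡o%m d (suc n) (toℕ a + toℕ b) d∣m)

χ : ∀ {ms} → List Bool → Carrier ms → Bool
χ ε = odd ∘ pairing ε

kernel : ∀ {ms} → List Bool → Subset {ms}
kernel ε = ker (χ ε)

dividesSelected-2 : ∀ {ms} → EvenModuli ms → ∀ ε → DividesSelected 2 ε ms
dividesSelected-2 []                []          = tt
dividesSelected-2 []                (_ ∷ _)     = tt
dividesSelected-2 (_ ∷ _)           []          = tt
dividesSelected-2 ((k , refl) ∷ ev) (true ∷ ε)  = 2∣2*suc k , dividesSelected-2 ev ε
dividesSelected-2 ((k , refl) ∷ ev) (false ∷ ε) = dividesSelected-2 ev ε

χ-isCharacter : ∀ {ms} → EvenModuli ms → (ε : List Bool) → IsCharacter (χ {ms} ε)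
χ-isCharacter ev ε x y = begin
  odd (pairing ε (x ⊕ y))                   ≡⟨ odd-cong-%2 (pairing ε (x ⊕ y)) (pairing ε x + pairing ε y)
                                                             (pairing-homo 2 ε (dividesSelected-2 ev ε) x y) ⟩
  odd (pairing ε x + pairing ε y)           ≡⟨ odd-+ (pairing ε x) (pairing ε y) ⟩
  odd (pairing ε x) xor odd (pairing ε y)   ∎

χ-∷ : ∀ {m ms} e ε (a : Fin m) (x : Carrier ms) → χ (e ∷ ε) (a , x) ≡ (e ∧ odd (toℕ a)) xor χ ε x
χ-∷ true  ε a x = odd-+ (toℕ a) (pairing ε x)
χ-∷ false ε a x = refl

character-∘ : ∀ {ms ns} {f : Carrier ns → Bool} {h : Carrier ms → Carrier ns} →
  IsCharacter f → IsHomomorphism h → IsCharacter (f ∘ h)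
character-∘ {f = f} {h} f-homo h-homo x y = trans (cong f (h-homo x y)) (f-homo (h x) (h y))

χ-pad : ∀ {n ms} e ε (x : Carrier ms) → χ (e ∷ ε) (pad {n} x) ≡ χ ε x
χ-pad e ε x = trans (χ-∷ e ε Fin.zero x) (cong (_xor χ ε x) (∧-zeroʳ e))

NonZeroBits : List Bool → Set
NonZeroBits = Any (_≡ true)

χ-zero : ∀ {ms} ε → ¬ NonZeroBits ε → (x : Carrier ms) → χ ε x ≡ false
χ-zero {[]}    ε           ε≡0 x       = refl
χ-zero {_ ∷ _} []          ε≡0 x       = refl
χ-zero {_ ∷ _} (true ∷ ε)  ε≡0 x       = contradiction (here refl) ε≡0
χ-zero {_ ∷ _} (false ∷ ε) ε≡0 (a , x) = χ-zero ε (ε≡0 ∘ there) x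

headᵇ : List Bool → Bool
headᵇ []      = false
headᵇ (e ∷ _) = e

tailᵇ : List Bool → List Bool
tailᵇ []      = []
tailᵇ (_ ∷ ε) = ε

χ-uncons : ∀ {m ms} ε (a : Fin m) (x : Carrier ms) → χ ε (a , x) ≡ (headᵇ ε ∧ odd (toℕ a)) xor χ (tailᵇ ε) x
χ-uncons []      a x = sym (χ-zero [] (λ ()) x)
χ-uncons (e ∷ ε) a x = χ-∷ e ε a x

pairing-0 : ∀ {ms} (ev : EvenModuli ms) ε → pairing ε (0ᴳ ev) ≡ 0
pairing-0 []                ε           = refl
pairing-0 (_ ∷ _)           []          = refl
pairing-0 ((k , refl) ∷ ev) (true ∷ ε)  = pairing-0 ev ε
pairing-0 ((k , refl) ∷ ev) (false ∷ ε) = pairing-0 ev ε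

χ-0ᴳ : ∀ {ms} (ev : EvenModuli ms) ε → χ ε (0ᴳ ev) ≡ false
χ-0ᴳ ev ε = cong odd (pairing-0 ev ε)

χ-unit : ∀ {k ms} (ev : EvenModuli ms) ε → χ ε (1ᶠ k , 0ᴳ ev) ≡ headᵇ ε
χ-unit {k} ev ε = begin
  χ ε (1ᶠ k , 0ᴳ ev)                                   ≡⟨ χ-uncons ε (1ᶠ k) (0ᴳ ev) ⟩
  (headᵇ ε ∧ odd (toℕ (1ᶠ k))) xor χ (tailᵇ ε) (0ᴳ ev) ≡⟨ cong₂ (λ n b → (headᵇ ε ∧ odd n) xor b) (toℕ-1ᶠ k) (χ-0ᴳ ev (tailᵇ ε)) ⟩
  (headᵇ ε ∧ true) xor false                           ≡⟨ trans (xor-identityʳ (headᵇ ε ∧ true)) (∧-identityʳ (headᵇ ε)) ⟩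
  headᵇ ε                                              ∎

pairing-pad : ∀ {n ms} e ε (x : Carrier ms) → pairing (e ∷ ε) (pad {n} x) ≡ pairing ε x
pairing-pad true  ε x = refl
pairing-pad false ε x = refl

coefficients : ∀ {ms} → EvenModuli ms → (Carrier ms → Bool) → List Bool
coefficients []                f = []
coefficients ((k , refl) ∷ ev) f = f (1ᶠ k , 0ᴳ ev) ∷ coefficients ev (f ∘ pad)

coefficients-length : ∀ {ms} (ev : EvenModuli ms) f → length (coefficients ev f) ≡ length ms
coefficients-length []                f = refl
coefficients-length ((k , refl) ∷ ev) f = cong suc (coefficients-length ev (f ∘ pad))

coefficients-cong : ∀ {ms} (ev : EvenModuli ms) {f g} → (∀ x → f x ≡ g x) → coefficients ev f ≡ coefficients ev g
coefficients-cong []                f≗g = refl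
coefficients-cong ((k , refl) ∷ ev) f≗g = cong₂ _∷_ (f≗g (1ᶠ k , 0ᴳ ev)) (coefficients-cong ev (f≗g ∘ pad))

character≗χ : ∀ {ms} (ev : EvenModuli ms) (f : Carrier ms → Bool) → IsCharacter f →
  ∀ x → f x ≡ χ (coefficients ev f) x
character≗χ []                f homo tt = trans (cong f (sym (⊕-identityˡ [] tt))) (character-0 [] f homo)
character≗χ ((k , refl) ∷ ev) f homo (a , x) = begin
  f (a , x)                                              ≡⟨ cong f split ⟨
  f ((a , 0ᴳ ev) ⊕ pad x)                                ≡⟨ homo (a , 0ᴳ ev) (pad x) ⟩
  f (a , 0ᴳ ev) xor f (pad x)                            ≡⟨ cong₂ _xor_ head-part tail-part ⟩
  (f (1ᶠ k , 0ᴳ ev) ∧ odd (toℕ a)) xor χ (coefficients ev (f ∘ pad)) x  ≡⟨ χ-∷ (f (1ᶠ k , 0ᴳ ev)) _ a x ⟨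
  χ (coefficients ((k , refl) ∷ ev) f) (a , x)           ∎
  where
  split : (a , 0ᴳ ev) ⊕ pad x ≡ (a , x)
  split = cong₂ _,_ (addMod-identityʳ a) (⊕-identityˡ ev x)
  head-part : f (a , 0ᴳ ev) ≡ f (1ᶠ k , 0ᴳ ev) ∧ odd (toℕ a)
  head-part = trans (cong f (sym (·-1ᶠ ev a)))
                    (trans (character-· ((k , refl) ∷ ev) f homo (toℕ a) (1ᶠ k , 0ᴳ ev)) (∧-comm (odd (toℕ a)) (f (1ᶠ k , 0ᴳ ev))))
  tail-part : f (pad x) ≡ χ (coefficients ev (f ∘ pad)) x
  tail-part = character≗χ ev (f ∘ pad) (character-∘ {f = f} {h = pad} homo pad-homo) x

coefficients-χ : ∀ {ms} (ev : EvenModuli ms) ε → length ε ≡ length ms → coefficients ev (χ ε) ≡ ε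
coefficients-χ []                []      _   = refl
coefficients-χ ((k , refl) ∷ ev) (e ∷ ε) len = cong₂ _∷_ (χ-unit ev (e ∷ ε)) (begin
  coefficients ev (χ (e ∷ ε) ∘ pad) ≡⟨ coefficients-cong ev (χ-pad e ε) ⟩
  coefficients ev (χ ε)             ≡⟨ coefficients-χ ev ε (suc-injective len) ⟩
  ε                                 ∎)

module _ {ms} (ev : EvenModuli ms) {H : Subset {ms}} (isSub : IsSubgroup H) (index2 : HasIndex2 H) where
  private
    closed   = proj₁ (proj₂ isSub)
    closed-⊖ = proj₂ (proj₂ isSub)

    complement-count : count (not ∘ H) (elements ms) ≡ count H (elements ms)
    complement-count = +-cancelˡ-≡ (count H (elements ms)) _ _ (begin
      count H (elements ms) + count (not ∘ H) (elements ms)  ≡⟨ count+count-not H (elements ms) ⟩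
      length (elements ms)                                   ≡⟨ index2 ⟩
      2 * count H (elements ms)                              ≡⟨ cong (count H (elements ms) +_) (+-identityʳ _) ⟩
      count H (elements ms) + count H (elements ms)          ∎)

    -- For x ∉ H the coset {y ∣ x ⊕ y ∈ H} avoids H and, as H has index 2, is as large as the complement of H.
    outside⊕outside : ∀ x y → H x ≡ false → H y ≡ false → (x ⊕ y) ∈ˢ H
    outside⊕outside x y x∉H y∉H =
      count-≡⇒⊇ (H ∘ (x ⊕_)) (not ∘ H) x⊕H⊆∁H (elements ms) same-size (∈-elements y) (cong not y∉H)
      where
      x⊕H⊆∁H : ∀ z → (x ⊕ z) ∈ˢ H → not (H z) ≡ true
      x⊕H⊆∁H z x⊕z∈H with H z in z∈H
      ... | false = refl
      ... | true  = contradiction (subst (_∈ˢ H) (⊕-cancelʳ ev x z) (closed _ _ x⊕z∈H (closed-⊖ z z∈H)))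
                                  (not-¬ x∉H)
      same-size : count (H ∘ (x ⊕_)) (elements ms) ≡ count (not ∘ H) (elements ms)
      same-size = trans (count-translate H x) (sym complement-count)

  complement-isCharacter : IsCharacter (not ∘ H)
  complement-isCharacter x y with H x in x∈H | H y in y∈H
  ... | true  | true  rewrite closed x y x∈H y∈H = refl
  ... | true  | false with H (x ⊕ y) in x⊕y∈H
  ...   | false = refl
  ...   | true  = contradiction (subst (_∈ˢ H) (⊖-cancelˡ ev x y) (closed _ _ (closed-⊖ x x∈H) x⊕y∈H)) (not-¬ y∈H)
  complement-isCharacter x y | false | true with H (x ⊕ y) in x⊕y∈H
  ...   | false = refl
  ...   | true  = contradiction (subst (_∈ˢ H) (⊕-cancelʳ ev x y) (closed _ _ x⊕y∈H (closed-⊖ y y∈H))) (not-¬ x∈H)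
  complement-isCharacter x y | false | false rewrite outside⊕outside x y x∈H y∈H = refl

  index2-kernel : ∀ x → H x ≡ kernel (coefficients ev (not ∘ H)) x
  index2-kernel x = trans (sym (not-involutive (H x)))
                          (cong not (character≗χ ev (not ∘ H) complement-isCharacter x))

  index2-proper : ¬ (∀ x → x ∈ˢ H)
  index2-proper H≡G = <-irrefl |G|≡2*|G| (m<m+n |G| (subst (0 <_) (sym (+-identityʳ |G|)) 0<|G|))
    where
    |G| = length (elements ms)
    0<|G| : 0 < |G|
    0<|G| = ∈-length (∈-elements (0ᴳ ev))
    |G|≡2*|G| : |G| ≡ 2 * |G|
    |G|≡2*|G| = trans index2 (cong (λ xs → 2 * length xs) (filter-all (λ x → H x Bool.≟ true) {elements ms} (All.tabulate (λ {x} _ → H≡G x))))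

  index2-coefficients-nonzero : NonZeroBits (coefficients ev (not ∘ H))
  index2-coefficients-nonzero = decidable-stable (any? (Bool._≟ true) _) λ ε≡0 →
    index2-proper (λ x → trans (index2-kernel x) (cong not (χ-zero _ ε≡0 x)))

-- The rank of kernel ε

hasRank-unique : ∀ {ms} {H : Subset {ms}} {k l} → HasRank H k → HasRank H l → k ≡ l
hasRank-unique ((gs , |gs|≡k , gen) , k-min) ((hs , |hs|≡l , gen′) , l-min) =
  ≤-antisym (subst (_ ≤_) |hs|≡l (k-min hs gen′)) (subst (_ ≤_) |gs|≡k (l-min gs gen))

generates-≐ : ∀ {ms} {H K : Subset {ms}} {gs} → H ≐ K → Generates gs K → Generates gs H
generates-≐ H≐K (gs⊆K , span) = All.map (λ {g} → trans (H≐K g)) gs⊆K , λ x x∈H → span x (trans (sym (H≐K x)) x∈H)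

hasRank-≐ : ∀ {ms} {H K : Subset {ms}} {k} → H ≐ K → HasRank K k → HasRank H k
hasRank-≐ H≐K ((gs , |gs|≡k , gen) , k-min) =
  (gs , |gs|≡k , generates-≐ H≐K gen) , λ hs gen′ → k-min hs (generates-≐ (λ x → sym (H≐K x)) gen′)

Fin[2^n]↔Vec : ∀ n → Fin (2 ^ n) ↔ Vec Bool n
Fin[2^n]↔Vec n = ↔-trans (Fin[m^n]↔Fin[m]^n 2 n) (↔-trans (lift↔ n 2↔Bool) (↔Vec n))

leftInverse⇒≤ : ∀ {m n} (f : Vec Bool m → Vec Bool n) (g : Vec Bool n → Vec Bool m) →
  (∀ v → g (f v) ≡ v) → m ≤ n
leftInverse⇒≤ {m} {n} f g g∘f≗id = ≮⇒≥ λ n<m → <⇒≱ (^-monoʳ-< 2 (s≤s (s≤s z≤n)) n<m) (injective⇒≤ h-injective)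
  where
  module Fm = Inverse (Fin[2^n]↔Vec m)
  module Fn = Inverse (Fin[2^n]↔Vec n)
  h : Fin (2 ^ m) → Fin (2 ^ n)
  h = Fn.from ∘ f ∘ Fm.to
  h-injective : ∀ {i j} → h i ≡ h j → i ≡ j
  h-injective {i} {j} hi≡hj = begin
    i                            ≡⟨ Fm.strictlyInverseʳ i ⟨
    Fm.from (Fm.to i)            ≡⟨ cong Fm.from (g∘f≗id (Fm.to i)) ⟨
    Fm.from (g (f (Fm.to i)))    ≡⟨ cong (Fm.from ∘ g) (Fn.strictlyInverseˡ (f (Fm.to i))) ⟨
    Fm.from (g (Fn.to (h i)))    ≡⟨ cong (Fm.from ∘ g ∘ Fn.to) hi≡hj ⟩
    Fm.from (g (Fn.to (h j)))    ≡⟨ cong (Fm.from ∘ g) (Fn.strictlyInverseˡ (f (Fm.to j))) ⟩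
    Fm.from (g (f (Fm.to j)))    ≡⟨ cong Fm.from (g∘f≗id (Fm.to j)) ⟩
    Fm.from (Fm.to j)            ≡⟨ Fm.strictlyInverseʳ j ⟩
    j                            ∎

_⊻_ : ∀ {k} → Vec Bool k → Vec Bool k → Vec Bool k
_⊻_ = zipWith _xor_

⊻-identityʳ : ∀ {k} (v : Vec Bool k) → v ⊻ Vec.replicate k false ≡ v
⊻-identityʳ = zipWith-identityʳ xor-identityʳ

⊻-self : ∀ {k} (v : Vec Bool k) → v ⊻ v ≡ Vec.replicate k false
⊻-self []      = refl
⊻-self (a ∷ v) = cong₂ _∷_ (xor-same a) (⊻-self v)

scale : ∀ {k} → Bool → Vec Bool k → Vec Bool k
scale true  v = v
scale false v = Vec.replicate _ false

module _ {ms} (ev : EvenModuli ms) {H : Subset {ms}} (isSub : IsSubgroup H) {k : ℕ}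
         (ψ : Carrier ms → Vec Bool k)
         (ψ-homo : ∀ x y → x ∈ˢ H → y ∈ˢ H → ψ (x ⊕ y) ≡ ψ x ⊻ ψ y)
         (ψ-onto : ∀ w → ∃ λ x → x ∈ˢ H × ψ x ≡ w) where
  private
    closed = proj₁ (proj₂ isSub)
    closed-⊖ = proj₂ (proj₂ isSub)

    0∈H : 0ᴳ ev ∈ˢ H
    0∈H = let (x , x∈H) = proj₁ isSub in subst (_∈ˢ H) (⊕-inverseʳ ev x) (closed x (⊖ x) x∈H (closed-⊖ x x∈H))

    ψ-0 : ψ (0ᴳ ev) ≡ Vec.replicate k false
    ψ-0 = trans (cong ψ (sym (⊕-identityˡ ev (0ᴳ ev)))) (trans (ψ-homo _ _ 0∈H 0∈H) (⊻-self _))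

    ψ-· : ∀ c x → x ∈ˢ H → (c · x) ∈ˢ H × ψ (c · x) ≡ scale (odd c) (ψ x)
    ψ-· zero    x x∈H = subst (_∈ˢ H) (sym (⊕-inverseʳ ev x)) 0∈H , trans (cong ψ (⊕-inverseʳ ev x)) ψ-0
    ψ-· (suc c) x x∈H with ψ-· c x x∈H
    ... | cx∈H , ψcx = closed x (c · x) x∈H cx∈H , trans (ψ-homo x (c · x) x∈H cx∈H) (trans (cong (ψ x ⊻_) ψcx) (step (odd c)))
      where
      step : ∀ b → ψ x ⊻ scale b (ψ x) ≡ scale (not b) (ψ x)
      step true  = ⊻-self (ψ x)
      step false = ⊻-identityʳ (ψ x)

    combination : (gs : List (Carrier ms)) → Vec Bool (length gs) → Vec Bool k
    combination []       []       = Vec.replicate k false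
    combination (g ∷ gs) (b ∷ bs) = scale b (ψ g) ⊻ combination gs bs

    ψ-comb : ∀ gs → All (_∈ˢ H) gs → (cs : Vec ℕ (length gs)) → ∀ z →
      comb gs cs (z ⊕ (⊖ z)) ∈ˢ H × ψ (comb gs cs (z ⊕ (⊖ z))) ≡ combination gs (Vec.map odd cs)
    ψ-comb []       []          []       z rewrite ⊕-inverseʳ ev z = 0∈H , ψ-0
    ψ-comb (g ∷ gs) (g∈H ∷ gs⊆H) (c ∷ cs) z with ψ-· c g g∈H | ψ-comb gs gs⊆H cs z
    ... | cg∈H , ψcg | rest∈H , ψrest = closed _ _ cg∈H rest∈H , trans (ψ-homo _ _ cg∈H rest∈H) (cong₂ _⊻_ ψcg ψrest)

  -- Reducing the coefficients mod 2, the images under ψ of any generating list span 𝔽₂ᵏ.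
  generators-≥ : ∀ gs → Generates gs H → k ≤ length gs
  generators-≥ gs (gs⊆H , span) = leftInverse⇒≤ coefficientsMod2 (combination gs) inverse
    where
    coefficientsMod2 : Vec Bool k → Vec Bool (length gs)
    coefficientsMod2 w = let (x , x∈H , _) = ψ-onto w in Vec.map odd (proj₁ (span x x∈H))
    inverse : ∀ w → combination gs (coefficientsMod2 w) ≡ w
    inverse w with ψ-onto w
    ... | x , x∈H , ψx≡w with span x x∈H
    ... | cs , z , comb≡x = trans (sym (proj₂ (ψ-comb gs gs⊆H cs z))) (trans (cong ψ comb≡x) ψx≡w)

Span : ∀ {ms} → EvenModuli ms → List (Carrier ms) → Carrier ms → Set
Span ev gs x = ∃ λ (cs : Vec ℕ (length gs)) → comb gs cs (0ᴳ ev) ≡ x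

span-cons : ∀ {ms} (ev : EvenModuli ms) {gs y} → Span ev gs y → ∀ c g → Span ev (g ∷ gs) ((c · g) ⊕ y)
span-cons ev (cs , refl) c g = c ∷ cs , refl

span-map : ∀ {ms ns} (ev : EvenModuli ms) (ev′ : EvenModuli ns) {f : Carrier ms → Carrier ns} →
  IsHomomorphism f → f (0ᴳ ev) ≡ 0ᴳ ev′ → ∀ gs {x} → Span ev gs x → Span ev′ (map f gs) (f x)
span-map ev ev′ homo f0 []       ([] , refl)       = [] , sym f0
span-map ev ev′ {f} homo f0 (g ∷ gs) (c ∷ cs , refl) with span-map ev ev′ homo f0 gs (cs , refl)
... | cs′ , eq = c ∷ cs′ , (begin
  (c · f g) ⊕ comb (map f gs) cs′ (0ᴳ ev′)   ≡⟨ cong₂ _⊕_ (homomorphism-· ev ev′ homo f0 c g) (sym eq) ⟨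
  f (c · g) ⊕ f (comb gs cs (0ᴳ ev))         ≡⟨ homo (c · g) (comb gs cs (0ᴳ ev)) ⟨
  f ((c · g) ⊕ comb gs cs (0ᴳ ev))           ∎)

span⇒generates : ∀ {ms} (ev : EvenModuli ms) {H : Subset {ms}} gs →
  All (_∈ˢ H) gs → (∀ x → x ∈ˢ H → Span ev gs x) → Generates gs H
span⇒generates ev gs gs⊆H span = gs⊆H , λ x x∈H →
  let (cs , eq) = span x x∈H in cs , 0ᴳ ev , trans (cong (comb gs cs) (⊕-inverseʳ ev (0ᴳ ev))) eq

parities : ∀ {ms} → Carrier ms → Vec Bool (length ms)
parities {[]}    tt      = []
parities {_ ∷ _} (a , x) = odd (toℕ a) ∷ parities x

parities-homo : ∀ {ms} → EvenModuli ms → (x y : Carrier ms) → parities (x ⊕ y) ≡ parities x ⊻ parities y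
parities-homo []                tt      tt      = refl
parities-homo ((k , refl) ∷ ev) (a , x) (b , y) = cong₂ _∷_ (odd-addMod k a b) (parities-homo ev x y)

parities-0 : ∀ {ms} (ev : EvenModuli ms) → parities (0ᴳ ev) ≡ Vec.replicate _ false
parities-0 []                = refl
parities-0 ((k , refl) ∷ ev) = cong (false ∷_) (parities-0 ev)

fromParities : ∀ {ms} → EvenModuli ms → Vec Bool (length ms) → Carrier ms
fromParities []                []      = tt
fromParities ((k , refl) ∷ ev) (b ∷ w) = bitᶠ k b , fromParities ev w

parities-fromParities : ∀ {ms} (ev : EvenModuli ms) w → parities (fromParities ev w) ≡ w
parities-fromParities []                []      = refl
parities-fromParities ((k , refl) ∷ ev) (b ∷ w) = cong₂ _∷_ (odd-bitᶠ k b) (parities-fromParities ev w)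

PivotModulus : Bool → ℕ → Set
PivotModulus true  m = 4 ∣ m
PivotModulus false m = m ≡ 2

-- A coordinate p with ε_p = true. On kernel ε the parity of x_p is determined by the other coordinates.
data Pivot (b : Bool) : List ℕ → List Bool → Set where
  here  : ∀ {m ms ε} → PivotModulus b m → Pivot b (m ∷ ms) (true ∷ ε)
  there : ∀ {m ms e ε} → Pivot b ms ε → Pivot b (m ∷ ms) (e ∷ ε)

others : ∀ {b ms ε} → Pivot b ms ε → ℕ
others (here {ms = ms} _) = length ms
others (there p)          = suc (others p)

suc-others : ∀ {b ms ε} (p : Pivot b ms ε) → suc (others p) ≡ length ms
suc-others (here _)  = refl
suc-others (there p) = cong suc (suc-others p)

paritiesExcept : ∀ {b ms ε} (p : Pivot b ms ε) → Carrier ms → Vec Bool (others p)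
paritiesExcept (here _)  (a , x) = parities x
paritiesExcept (there p) (a , x) = odd (toℕ a) ∷ paritiesExcept p x

paritiesExcept-homo : ∀ {b ms ε} → EvenModuli ms → (p : Pivot b ms ε) → (x y : Carrier ms) →
  paritiesExcept p (x ⊕ y) ≡ paritiesExcept p x ⊻ paritiesExcept p y
paritiesExcept-homo ((k , refl) ∷ ev) (here _)  (a , x) (b , y) = parities-homo ev x y
paritiesExcept-homo ((k , refl) ∷ ev) (there p) (a , x) (b , y) = cong₂ _∷_ (odd-addMod k a b) (paritiesExcept-homo ev p x y)

withParities : ∀ {b ms ε} → EvenModuli ms → (p : Pivot b ms ε) → Vec Bool (others p) → Bool → Carrier ms
withParities ((k , refl) ∷ ev) (here {ε = ε} _)   w       t = bitᶠ k (t xor χ ε (fromParities ev w)) , fromParities ev w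
withParities ((k , refl) ∷ ev) (there {e = e} p) (b ∷ w) t = bitᶠ k b , withParities ev p w (t xor (e ∧ b))

paritiesExcept-withParities : ∀ {b ms ε} (ev : EvenModuli ms) (p : Pivot b ms ε) w t →
  paritiesExcept p (withParities ev p w t) ≡ w
paritiesExcept-withParities ((k , refl) ∷ ev) (here _)  w       t = parities-fromParities ev w
paritiesExcept-withParities ((k , refl) ∷ ev) (there p) (b ∷ w) t = cong₂ _∷_ (odd-bitᶠ k b) (paritiesExcept-withParities ev p w _)

χ-withParities : ∀ {b ms ε} (ev : EvenModuli ms) (p : Pivot b ms ε) w t → χ ε (withParities ev p w t) ≡ t
χ-withParities ((k , refl) ∷ ev) (here {ε = ε} _) w t = begin
  χ (true ∷ ε) (bitᶠ k c , y)      ≡⟨ χ-∷ true ε (bitᶠ k c) y ⟩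
  odd (toℕ (bitᶠ k c)) xor χ ε y   ≡⟨ cong (_xor χ ε y) (odd-bitᶠ k c) ⟩
  (t xor χ ε y) xor χ ε y          ≡⟨ xor-cancelʳ t (χ ε y) ⟩
  t                                ∎
  where
  y = fromParities ev w
  c = t xor χ ε y
χ-withParities ((k , refl) ∷ ev) (there {e = e} {ε = ε} p) (b ∷ w) t = begin
  χ (e ∷ ε) (bitᶠ k b , y)                 ≡⟨ χ-∷ e ε (bitᶠ k b) y ⟩
  (e ∧ odd (toℕ (bitᶠ k b))) xor χ ε y     ≡⟨ cong₂ (λ c d → (e ∧ c) xor d) (odd-bitᶠ k b) (χ-withParities ev p w (t xor (e ∧ b))) ⟩
  (e ∧ b) xor (t xor (e ∧ b))              ≡⟨ xor-comm (e ∧ b) (t xor (e ∧ b)) ⟩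
  (t xor (e ∧ b)) xor (e ∧ b)              ≡⟨ xor-cancelʳ t (e ∧ b) ⟩
  t                                        ∎
  where
  y = withParities ev p w (t xor (e ∧ b))

pivot-hasIndex2 : ∀ {b ms ε} (ev : EvenModuli ms) → Pivot b ms ε → HasIndex2 {ms} (kernel ε)
pivot-hasIndex2 {ε = ε} ev p = ker-hasIndex2 ev (χ ε) (χ-isCharacter ev ε) (withParities ev p (Vec.replicate _ false) true)
                                              (χ-withParities ev p _ true)

-- For the pivot p in front: the elements ε_i e_p + e_i for the other unit vectors e_i.
tailGenerators : ∀ k {ms} → EvenModuli ms → List Bool → List (Carrier (2 * suc k ∷ ms))
tailGenerators k []                 ε = []
tailGenerators k ((k′ , refl) ∷ ev) ε =
  (bitᶠ k (headᵇ ε) , (1ᶠ k′ , 0ᴳ ev)) ∷ map (padSecond k′) (tailGenerators k ev (tailᵇ ε))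

tailGenerators-length : ∀ k {ms} (ev : EvenModuli ms) ε → length (tailGenerators k ev ε) ≡ length ms
tailGenerators-length k []                 ε = refl
tailGenerators-length k ((k′ , refl) ∷ ev) ε =
  cong suc (trans (length-map (padSecond k′) (tailGenerators k ev (tailᵇ ε))) (tailGenerators-length k ev (tailᵇ ε)))

tailGenerators-⊆ : ∀ k {ms} (ev : EvenModuli ms) ε → All (_∈ˢ kernel (true ∷ ε)) (tailGenerators k ev ε)
tailGenerators-⊆ k []                 ε = []
tailGenerators-⊆ k ((k′ , refl) ∷ ev) ε =
  generator∈ ∷ All.map⁺ (All.map (λ {z} → padSecond∈ z) (tailGenerators-⊆ k ev (tailᵇ ε)))
  where
  generator∈ : (bitᶠ k (headᵇ ε) , (1ᶠ k′ , 0ᴳ ev)) ∈ˢ kernel (true ∷ ε)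
  generator∈ = cong not (begin
    χ (true ∷ ε) (bitᶠ k (headᵇ ε) , (1ᶠ k′ , 0ᴳ ev))       ≡⟨ χ-∷ true ε (bitᶠ k (headᵇ ε)) (1ᶠ k′ , 0ᴳ ev) ⟩
    odd (toℕ (bitᶠ k (headᵇ ε))) xor χ ε (1ᶠ k′ , 0ᴳ ev)  ≡⟨ cong₂ _xor_ (odd-bitᶠ k (headᵇ ε)) (χ-unit ev ε) ⟩
    headᵇ ε xor headᵇ ε                                     ≡⟨ xor-same (headᵇ ε) ⟩
    false                                                   ∎)
  padSecond∈ : ∀ z → z ∈ˢ kernel (true ∷ tailᵇ ε) → padSecond k′ z ∈ˢ kernel (true ∷ ε)
  padSecond∈ (a , y) z∈ = trans (cong not (begin
    χ (true ∷ ε) (a , pad y)                                ≡⟨ χ-∷ true ε a (pad y) ⟩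
    odd (toℕ a) xor χ ε (pad y)                             ≡⟨ cong (odd (toℕ a) xor_) (χ-uncons ε Fin.zero y) ⟩
    odd (toℕ a) xor ((headᵇ ε ∧ false) xor χ (tailᵇ ε) y)   ≡⟨ cong (λ c → odd (toℕ a) xor (c xor χ (tailᵇ ε) y)) (∧-zeroʳ (headᵇ ε)) ⟩
    odd (toℕ a) xor χ (tailᵇ ε) y                           ≡⟨ χ-∷ true (tailᵇ ε) a y ⟨
    χ (true ∷ tailᵇ ε) (a , y)                              ∎)) z∈

tailGenerators-span : ∀ k {ms} (ev : EvenModuli ms) ε (x : Carrier ms) →
  ∃ λ (a : Fin (2 * suc k)) → odd (toℕ a) ≡ χ ε x × Span ((k , refl) ∷ ev) (tailGenerators k ev ε) (a , x)
tailGenerators-span k []                 ε tt = Fin.zero , refl , [] , refl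
tailGenerators-span k ((k′ , refl) ∷ ev) ε (b , y) with tailGenerators-span k ev (tailᵇ ε) y
... | a , odd-a , span = proj₁ z , odd-z , subst (Span G (g ∷ gs)) z≡ (span-cons G span′ (toℕ b) g)
  where
  G : EvenModuli (2 * suc k ∷ 2 * suc k′ ∷ _)
  G = (k , refl) ∷ (k′ , refl) ∷ ev
  g  = bitᶠ k (headᵇ ε) , (1ᶠ k′ , 0ᴳ ev)
  gs = map (padSecond k′) (tailGenerators k ev (tailᵇ ε))
  span′ = span-map ((k , refl) ∷ ev) G (padSecond-homo k′) refl (tailGenerators k ev (tailᵇ ε)) span
  z = (toℕ b · g) ⊕ padSecond k′ (a , y)
  z≡ : z ≡ (proj₁ z , (b , y))
  z≡ = cong (proj₁ z ,_) (begin
    proj₂ (toℕ b · g) ⊕ pad y       ≡⟨ cong (_⊕ pad y) (trans (proj₂-· (toℕ b) (bitᶠ k (headᵇ ε)) (1ᶠ k′ , 0ᴳ ev)) (·-1ᶠ ev b)) ⟩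
    (b , 0ᴳ ev) ⊕ pad y             ≡⟨ cong₂ _,_ (addMod-identityʳ b) (⊕-identityˡ ev y) ⟩
    (b , y)                         ∎)
  odd-z : odd (toℕ (proj₁ z)) ≡ χ ε (b , y)
  odd-z = begin
    odd (toℕ (addMod (proj₁ (toℕ b · g)) a))                  ≡⟨ odd-addMod k (proj₁ (toℕ b · g)) a ⟩
    odd (toℕ (proj₁ (toℕ b · g))) xor odd (toℕ a)             ≡⟨ cong₂ _xor_ (trans (cong odd (toℕ-proj₁-· (toℕ b) (bitᶠ k (headᵇ ε)) (1ᶠ k′ , 0ᴳ ev)))
                                                                                    (odd-·-bitᶠ k (toℕ b) (headᵇ ε))) odd-a ⟩
    (headᵇ ε ∧ odd (toℕ b)) xor χ (tailᵇ ε) y                 ≡⟨ χ-uncons ε b y ⟨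
    χ ε (b , y)                                               ∎

generators : ∀ {b ms ε} → EvenModuli ms → Pivot b ms ε → List (Carrier ms)
generators         ((k , refl) ∷ ev) (there {e = e} p)  =
  (1ᶠ k , withParities ev p (Vec.replicate _ false) e) ∷ map pad (generators ev p)
generators {true}  ((k , refl) ∷ ev) (here {ε = ε} 4∣M) = (2ᶠ k 4∣M , 0ᴳ ev) ∷ tailGenerators k ev ε
generators {false} ((k , refl) ∷ ev) (here {ε = ε} _)   = tailGenerators k ev ε

generators-length : ∀ {b ms ε} (ev : EvenModuli ms) (p : Pivot b ms ε) →
  length (generators ev p) ≡ others p + (if b then 1 else 0)
generators-length {true}  ((k , refl) ∷ ev) (here {ε = ε} _) = trans (cong suc (tailGenerators-length k ev ε)) (+-comm 1 _)
generators-length {false} ((k , refl) ∷ ev) (here {ε = ε} _) = trans (tailGenerators-length k ev ε) (sym (+-identityʳ _))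
generators-length         ((k , refl) ∷ ev) (there p)        = cong suc (trans (length-map pad (generators ev p)) (generators-length ev p))

generators-⊆ : ∀ {b ms ε} (ev : EvenModuli ms) (p : Pivot b ms ε) → All (_∈ˢ kernel ε) (generators ev p)
generators-⊆ {true}  ((k , refl) ∷ ev) (here {ε = ε} 4∣M) = two∈ ∷ tailGenerators-⊆ k ev ε
  where
  two∈ : (2ᶠ k 4∣M , 0ᴳ ev) ∈ˢ kernel (true ∷ ε)
  two∈ = cong not (trans (χ-∷ true ε (2ᶠ k 4∣M) (0ᴳ ev))
                         (cong₂ _xor_ (cong odd (toℕ-2ᶠ k 4∣M)) (χ-0ᴳ ev ε)))
generators-⊆ {false} ((k , refl) ∷ ev) (here {ε = ε} _)   = tailGenerators-⊆ k ev ε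
generators-⊆         ((k , refl) ∷ ev) (there {e = e} {ε = ε} p) =
  generator∈ ∷ All.map⁺ (All.map (λ {z} z∈ → trans (cong not (χ-pad e ε z)) z∈) (generators-⊆ ev p))
  where
  w = withParities ev p (Vec.replicate _ false) e
  generator∈ : (1ᶠ k , w) ∈ˢ kernel (e ∷ ε)
  generator∈ = cong not (begin
    χ (e ∷ ε) (1ᶠ k , w)                   ≡⟨ χ-∷ e ε (1ᶠ k) w ⟩
    (e ∧ odd (toℕ (1ᶠ k))) xor χ ε w       ≡⟨ cong₂ (λ c d → (e ∧ odd c) xor d) (toℕ-1ᶠ k) (χ-withParities ev p _ e) ⟩
    (e ∧ true) xor e                       ≡⟨ cong (_xor e) (∧-identityʳ e) ⟩
    e xor e                                ≡⟨ xor-same e ⟩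
    false                                  ∎)

tailGenerators-span-even : ∀ k {ms} (ev : EvenModuli ms) ε x → x ∈ˢ kernel (true ∷ ε) →
  ∃ λ (d : Fin (2 * suc k)) → 2 ∣ toℕ d ×
  ∃ λ y → Span ((k , refl) ∷ ev) (tailGenerators k ev ε) y × y ⊕ (d , 0ᴳ ev) ≡ x
tailGenerators-span-even k ev ε (a , x) a,x∈ with tailGenerators-span k ev ε x
... | a₀ , odd-a₀ , span = d , even⇒2∣ (toℕ d) odd-d , (a₀ , x) , span , cong₂ _,_ (addMod-cancelˡ a₀ a) (⊕-identityʳ ev x)
  where
  d = addMod (negMod a₀) a
  odd-a : odd (toℕ a) ≡ χ ε x
  odd-a = xor≡false⇒≡ _ _ (trans (sym (χ-∷ true ε a x)) (not-injective a,x∈))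
  odd-d : odd (toℕ d) ≡ false
  odd-d = begin
    odd (toℕ d)                                   ≡⟨ xor-cancelʳ (odd (toℕ d)) (odd (toℕ a₀)) ⟨
    (odd (toℕ d) xor odd (toℕ a₀)) xor odd (toℕ a₀) ≡⟨ cong (_xor odd (toℕ a₀)) (xor-comm (odd (toℕ d)) (odd (toℕ a₀))) ⟩
    (odd (toℕ a₀) xor odd (toℕ d)) xor odd (toℕ a₀) ≡⟨ cong (_xor odd (toℕ a₀)) (odd-addMod k a₀ d) ⟨
    odd (toℕ (addMod a₀ d)) xor odd (toℕ a₀)       ≡⟨ cong₂ (λ b c → odd (toℕ b) xor c) (addMod-cancelˡ a₀ a) odd-a₀ ⟩
    odd (toℕ a) xor χ ε x                         ≡⟨ cong (_xor χ ε x) odd-a ⟩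
    χ ε x xor χ ε x                               ≡⟨ xor-same (χ ε x) ⟩
    false                                         ∎

generators-span : ∀ {b ms ε} (ev : EvenModuli ms) (p : Pivot b ms ε) → ∀ x → x ∈ˢ kernel ε → Span ev (generators ev p) x
generators-span ((k , refl) ∷ ev) (there {e = e} {ε = ε} p) (a , x) a,x∈ =
  subst (Span G (generators G (there p))) a,x≡ (span-cons G (span-map ev G pad-homo refl (generators ev p) span) c (1ᶠ k , w))
  where
  G = (k , refl) ∷ ev
  c = toℕ a
  w = withParities ev p (Vec.replicate _ false) e
  y = (⊖ (c · w)) ⊕ x
  y∈ : y ∈ˢ kernel ε
  y∈ = cong not (begin
    χ ε ((⊖ (c · w)) ⊕ x)           ≡⟨ χ-isCharacter ev ε (⊖ (c · w)) x ⟩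
    χ ε (⊖ (c · w)) xor χ ε x        ≡⟨ cong₂ _xor_ (trans (character-⊖ ev (χ ε) (χ-isCharacter ev ε) (c · w))
                                                           (character-· ev (χ ε) (χ-isCharacter ev ε) c w)) (sym odd-a) ⟩
    (odd c ∧ χ ε w) xor (e ∧ odd c)  ≡⟨ cong (λ t → (odd c ∧ t) xor (e ∧ odd c)) (χ-withParities ev p _ e) ⟩
    (odd c ∧ e) xor (e ∧ odd c)      ≡⟨ cong ((odd c ∧ e) xor_) (∧-comm e (odd c)) ⟩
    (odd c ∧ e) xor (odd c ∧ e)      ≡⟨ xor-same (odd c ∧ e) ⟩
    false                            ∎)
    where
    odd-a : e ∧ odd c ≡ χ ε x
    odd-a = xor≡false⇒≡ _ _ (trans (sym (χ-∷ e ε a x)) (not-injective a,x∈))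
  span = generators-span ev p y y∈
  a,x≡ : (c · (1ᶠ k , w)) ⊕ pad y ≡ (a , x)
  a,x≡ = cong₂ _,_ (trans (addMod-identityʳ _) (proj₁-·-1ᶠ a w))
                   (trans (cong (_⊕ y) (proj₂-· c (1ᶠ k) w)) (⊕-cancelˡ ev (c · w) x))
generators-span {true} ((k , refl) ∷ ev) (here {ε = ε} 4∣M) x x∈ with tailGenerators-span-even k ev ε x x∈
... | d , divides q d≡2q , y , span , y+d≡x =
  subst (Span G ((2ᶠ k 4∣M , 0ᴳ ev) ∷ tailGenerators k ev ε)) 2q+y≡x (span-cons G span q (2ᶠ k 4∣M , 0ᴳ ev))
  where
  G = (k , refl) ∷ ev
  2q+y≡x : (q · (2ᶠ k 4∣M , 0ᴳ ev)) ⊕ y ≡ x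
  2q+y≡x = begin
    (q · (2ᶠ k 4∣M , 0ᴳ ev)) ⊕ y  ≡⟨ cong (_⊕ y) (·-2ᶠ ev 4∣M d q d≡2q) ⟩
    (d , 0ᴳ ev) ⊕ y               ≡⟨ ⊕-comm (d , 0ᴳ ev) y ⟩
    y ⊕ (d , 0ᴳ ev)               ≡⟨ y+d≡x ⟩
    x                             ∎
generators-span {false} ((k , refl) ∷ ev) (here {ε = ε} M≡2) x x∈ with tailGenerators-span-even k ev ε x x∈
... | d , 2∣d , y , span , y+d≡x = subst (Span G (tailGenerators k ev ε)) y≡x span
  where
  G = (k , refl) ∷ ev
  -- m_p = 2, so the even part d vanishes and no generator 2 e_p is needed.
  d≡0 : d ≡ Fin.zero
  d≡0 = toℕ-injective (even<2 2∣d (subst (toℕ d <_) M≡2 (toℕ<n d)))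
    where
    even<2 : ∀ {n} → 2 ∣ n → n < 2 → n ≡ 0
    even<2 (divides zero    n≡0)  _                = n≡0
    even<2 (divides (suc q) refl) (s≤s (s≤s ()))
  y≡x : y ≡ x
  y≡x = trans (sym (⊕-identityʳ G y)) (trans (cong (λ t → y ⊕ (t , 0ᴳ ev)) (sym d≡0)) y+d≡x)

kernel-hasRank-others : ∀ {ms ε} (ev : EvenModuli ms) (p : Pivot false ms ε) → HasRank (kernel ε) (others p)
kernel-hasRank-others {ε = ε} ev p =
  (generators ev p , trans (generators-length ev p) (+-identityʳ (others p)) ,
   span⇒generates ev (generators ev p) (generators-⊆ ev p) (generators-span ev p)) ,
  generators-≥ ev {H = kernel ε} (ker-isSubgroup ev (χ ε) (χ-isCharacter ev ε)) (paritiesExcept p)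
    (λ x y _ _ → paritiesExcept-homo ev p x y)
    (λ w → withParities ev p w false , cong not (χ-withParities ev p w false) , paritiesExcept-withParities ev p w false)

twoAtPivot : ∀ {ms ε} → EvenModuli ms → Pivot true ms ε → Carrier ms
twoAtPivot ((k , refl) ∷ ev) (here 4∣M) = 2ᶠ k 4∣M , 0ᴳ ev
twoAtPivot ((k , refl) ∷ ev) (there p)  = pad (twoAtPivot ev p)

pairing-twoAtPivot : ∀ {ms ε} (ev : EvenModuli ms) (p : Pivot true ms ε) → pairing ε (twoAtPivot ev p) ≡ 2
pairing-twoAtPivot ((k , refl) ∷ ev) (here {ε = ε} 4∣M) = cong₂ _+_ (toℕ-2ᶠ k 4∣M) (pairing-0 ev ε)
pairing-twoAtPivot ((k , refl) ∷ ev) (there {e = e} {ε = ε} p) =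
  trans (pairing-pad e ε (twoAtPivot ev p)) (pairing-twoAtPivot ev p)

paritiesExcept-twoAtPivot : ∀ {ms ε} (ev : EvenModuli ms) (p : Pivot true ms ε) →
  paritiesExcept p (twoAtPivot ev p) ≡ Vec.replicate _ false
paritiesExcept-twoAtPivot ((k , refl) ∷ ev) (here _)  = parities-0 ev
paritiesExcept-twoAtPivot ((k , refl) ∷ ev) (there p) = cong (false ∷_) (paritiesExcept-twoAtPivot ev p)

-- When 4 ∣ m_p, the map kernel ε → kernel ε / 2 kernel ε ≅ 𝔽₂ⁿ: besides the parities of the coordinates other
-- than p, it records ⌊pairing ε x / 2⌋ mod 2, which is additive on kernel ε because pairing ε x is even there.
module _ {ms ε} (ev : EvenModuli ms) (p : Pivot true ms ε) (4∣ε : DividesSelected 4 ε ms) where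

  half : Carrier ms → Bool
  half x = oddHalf (pairing ε x)

  half-homo : ∀ x y → half (x ⊕ y) ≡ (half x xor half y) xor (χ ε x ∧ χ ε y)
  half-homo x y = trans (oddHalf-cong-%4 (pairing ε (x ⊕ y)) (pairing ε x + pairing ε y) (pairing-homo 4 ε 4∣ε x y))
                        (oddHalf-+ (pairing ε x) (pairing ε y))

  halfAndParities : Carrier ms → Vec Bool (suc (others p))
  halfAndParities x = half x ∷ paritiesExcept p x

  halfAndParities-homo : ∀ x y → x ∈ˢ kernel ε → y ∈ˢ kernel ε →
    halfAndParities (x ⊕ y) ≡ halfAndParities x ⊻ halfAndParities y
  halfAndParities-homo x y x∈ y∈ = cong₂ _∷_ (begin
    half (x ⊕ y)                                ≡⟨ half-homo x y ⟩
    (half x xor half y) xor (χ ε x ∧ χ ε y)     ≡⟨ cong (λ b → (half x xor half y) xor (b ∧ χ ε y)) (not-injective x∈) ⟩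
    (half x xor half y) xor false               ≡⟨ xor-identityʳ (half x xor half y) ⟩
    half x xor half y                           ∎)
    (paritiesExcept-homo ev p x y)

  halfAndParities-onto : ∀ v → ∃ λ x → x ∈ˢ kernel ε × halfAndParities x ≡ v
  halfAndParities-onto (c ∷ w) = adjust (half x₀ Bool.≟ c)
    where
    x₀ = withParities ev p w false
    t  = twoAtPivot ev p
    χ-x₀ : χ ε x₀ ≡ false
    χ-x₀ = χ-withParities ev p w false
    χ-t : χ ε t ≡ false
    χ-t = cong odd (pairing-twoAtPivot ev p)
    x₀+t∈ : (x₀ ⊕ t) ∈ˢ kernel ε
    x₀+t∈ = cong not (trans (χ-isCharacter ev ε x₀ t) (cong₂ _xor_ χ-x₀ χ-t))
    parities-x₀+t : paritiesExcept p (x₀ ⊕ t) ≡ w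
    parities-x₀+t = begin
      paritiesExcept p (x₀ ⊕ t)                 ≡⟨ paritiesExcept-homo ev p x₀ t ⟩
      paritiesExcept p x₀ ⊻ paritiesExcept p t  ≡⟨ cong₂ _⊻_ (paritiesExcept-withParities ev p w false) (paritiesExcept-twoAtPivot ev p) ⟩
      w ⊻ Vec.replicate _ false                 ≡⟨ ⊻-identityʳ w ⟩
      w                                         ∎
    half-x₀+t : half (x₀ ⊕ t) ≡ not (half x₀)
    half-x₀+t = begin
      half (x₀ ⊕ t)                             ≡⟨ half-homo x₀ t ⟩
      (half x₀ xor half t) xor (χ ε x₀ ∧ χ ε t)  ≡⟨ cong₂ (λ b c → (half x₀ xor oddHalf b) xor (χ ε x₀ ∧ c)) (pairing-twoAtPivot ev p) χ-t ⟩
      (half x₀ xor true) xor (χ ε x₀ ∧ false)    ≡⟨ cong₂ _xor_ (xor-comm (half x₀) true) (∧-zeroʳ (χ ε x₀)) ⟩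
      (true xor half x₀) xor false              ≡⟨ trans (xor-identityʳ (true xor half x₀)) (true-xor (half x₀)) ⟩
      not (half x₀)                             ∎
    adjust : Dec (half x₀ ≡ c) → ∃ λ x → x ∈ˢ kernel ε × halfAndParities x ≡ c ∷ w
    adjust (yes half≡c) = x₀ , cong not χ-x₀ , cong₂ _∷_ half≡c (paritiesExcept-withParities ev p w false)
    adjust (no  half≢c) = x₀ ⊕ t , x₀+t∈ ,
      cong₂ _∷_ (trans half-x₀+t (trans (cong not (¬-not half≢c)) (not-involutive c))) parities-x₀+t

kernel-hasRank-length : ∀ {ms ε} (ev : EvenModuli ms) (p : Pivot true ms ε) → DividesSelected 4 ε ms → HasRank (kernel ε) (length ms)
kernel-hasRank-length {ms} {ε} ev p 4∣ε =
  (generators ev p , trans (generators-length ev p) (trans (+-comm (others p) 1) (suc-others p)) ,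
   span⇒generates ev (generators ev p) (generators-⊆ ev p) (generators-span ev p)) ,
  subst (λ n → ∀ (gs : List (Carrier ms)) → Generates gs (kernel ε) → n ≤ length gs) (suc-others p)
    (generators-≥ ev {H = kernel ε} (ker-isSubgroup ev (χ ε) (χ-isCharacter ev ε)) (halfAndParities ev p 4∣ε)
      (halfAndParities-homo ev p 4∣ε) (halfAndParities-onto ev p 4∣ε))

nonzero⇒pivot : ∀ {b ms v} → All (PivotModulus b) ms → length v ≡ length ms → NonZeroBits v → Pivot b ms v
nonzero⇒pivot (pm ∷ _)   _   (here refl) = here pm
nonzero⇒pivot (_ ∷ pms) len (there v≢0) = there (nonzero⇒pivot pms (suc-injective len) v≢0)

pivot-++ʳ : ∀ {b ms ε} ms′ ε′ → Pivot b ms ε → Pivot b (ms ++ ms′) (ε ++ ε′)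
pivot-++ʳ ms′ ε′ (here pm) = here pm
pivot-++ʳ ms′ ε′ (there p) = there (pivot-++ʳ ms′ ε′ p)

pivot-++ˡ : ∀ {b ms′ ε} ms (u : List Bool) → length u ≡ length ms → Pivot b ms′ ε → Pivot b (ms ++ ms′) (u ++ ε)
pivot-++ˡ []       []      _   p = p
pivot-++ˡ (_ ∷ ms) (_ ∷ u) len p = there (pivot-++ˡ ms u (suc-injective len) p)

dividesSelected-++ : ∀ {d ms′ ε} ms (v : List Bool) → length v ≡ length ms →
  DividesSelected d v ms → DividesSelected d ε ms′ → DividesSelected d (v ++ ε) (ms ++ ms′)
dividesSelected-++ []       []          _   _          D′ = D′
dividesSelected-++ (_ ∷ ms) (true ∷ v)  len (d∣m , D)  D′ = d∣m , dividesSelected-++ ms v (suc-injective len) D D′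
dividesSelected-++ (_ ∷ ms) (false ∷ v) len D          D′ = dividesSelected-++ ms v (suc-injective len) D D′

dividesSelected-all : ∀ {d ms} → All (d ∣_) ms → ∀ v → DividesSelected d v ms
dividesSelected-all []            v           = tt
dividesSelected-all (_ ∷ _)       []          = tt
dividesSelected-all (d∣m ∷ d∣ms) (true ∷ v)  = d∣m , dividesSelected-all d∣ms v
dividesSelected-all (_ ∷ d∣ms)   (false ∷ v) = dividesSelected-all d∣ms v

dividesSelected-none : ∀ {d} ms r → DividesSelected d (replicate r false) ms
dividesSelected-none []       r       = tt
dividesSelected-none (_ ∷ _)  zero    = tt
dividesSelected-none (_ ∷ ms) (suc r) = dividesSelected-none ms r

-- Enumerating coefficient vectors

prefixed : ℕ → List (List Bool) → List (List Bool)
prefixed zero    L = L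
prefixed (suc n) L = map (true ∷_) (prefixed n L) ++ map (false ∷_) (prefixed n L)

nonzeroBits : ℕ → List (List Bool)
nonzeroBits zero    = []
nonzeroBits (suc n) = map (true ∷_) (prefixed n ([] ∷ [])) ++ map (false ∷_) (nonzeroBits n)

length-prefixed : ∀ n L → length (prefixed n L) ≡ 2 ^ n * length L
length-prefixed zero    L = sym (+-identityʳ (length L))
length-prefixed (suc n) L = begin
  length (map (true ∷_) (prefixed n L) ++ map (false ∷_) (prefixed n L))         ≡⟨ length-++ (map (true ∷_) (prefixed n L)) ⟩
  length (map (true ∷_) (prefixed n L)) + length (map (false ∷_) (prefixed n L)) ≡⟨ cong₂ _+_ (length-map _ (prefixed n L)) (length-map _ (prefixed n L)) ⟩
  length (prefixed n L) + length (prefixed n L)                                  ≡⟨ cong (λ t → t + t) (length-prefixed n L) ⟩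
  2 ^ n * length L + 2 ^ n * length L                                            ≡⟨ cong (2 ^ n * length L +_) (+-identityʳ _) ⟨
  2 * (2 ^ n * length L)                                                         ≡⟨ *-assoc 2 (2 ^ n) (length L) ⟨
  2 ^ suc n * length L                                                           ∎

length-nonzeroBits : ∀ n → length (nonzeroBits n) ≡ 2 ^ n ∸ 1
length-nonzeroBits n = trans (sym (m+n∸n≡m (length (nonzeroBits n)) 1)) (cong (_∸ 1) (+1 n))
  where
  +1 : ∀ n → length (nonzeroBits n) + 1 ≡ 2 ^ n
  +1 zero    = refl
  +1 (suc n) = begin
    length (map (true ∷_) (prefixed n ([] ∷ [])) ++ map (false ∷_) (nonzeroBits n)) + 1     ≡⟨ cong (_+ 1) (length-++ (map (true ∷_) (prefixed n ([] ∷ [])))) ⟩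
    length (map (true ∷_) (prefixed n ([] ∷ []))) + length (map (false ∷_) (nonzeroBits n)) + 1
      ≡⟨ cong₂ (λ s t → s + t + 1) (length-map _ (prefixed n ([] ∷ []))) (length-map _ (nonzeroBits n)) ⟩
    length (prefixed n ([] ∷ [])) + length (nonzeroBits n) + 1                                ≡⟨ +-assoc (length (prefixed n ([] ∷ []))) _ 1 ⟩
    length (prefixed n ([] ∷ [])) + (length (nonzeroBits n) + 1)                              ≡⟨ cong₂ _+_ (trans (length-prefixed n _) (*-identityʳ _)) (+1 n) ⟩
    2 ^ n + 2 ^ n                                                                           ≡⟨ cong (2 ^ n +_) (+-identityʳ _) ⟨
    2 ^ suc n                                                                               ∎

∈-prefixed⁺ : ∀ n (u : List Bool) {v L} → length u ≡ n → v ∈ L → u ++ v ∈ prefixed n L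
∈-prefixed⁺ zero    []          refl v∈L = v∈L
∈-prefixed⁺ (suc n) (true ∷ u)  len  v∈L = ∈-++⁺ˡ (∈-map⁺ (true ∷_) (∈-prefixed⁺ n u (suc-injective len) v∈L))
∈-prefixed⁺ (suc n) (false ∷ u) {L = L} len v∈L =
  ∈-++⁺ʳ (map (true ∷_) (prefixed n L)) (∈-map⁺ (false ∷_) (∈-prefixed⁺ n u (suc-injective len) v∈L))

∈-prefixed⁻ : ∀ n L {ε} → ε ∈ prefixed n L → ∃₂ λ u v → ε ≡ u ++ v × length u ≡ n × v ∈ L
∈-prefixed⁻ zero    L {ε} ε∈ = [] , ε , refl , refl , ε∈
∈-prefixed⁻ (suc n) L     ε∈ with ∈-++⁻ (map (true ∷_) (prefixed n L)) ε∈
... | inj₁ ε∈₁ with ∈-map⁻ (true ∷_) ε∈₁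
...   | _ , ε′∈ , refl with ∈-prefixed⁻ n L ε′∈
...     | u , v , refl , len , v∈L = true ∷ u , v , refl , cong suc len , v∈L
∈-prefixed⁻ (suc n) L     ε∈ | inj₂ ε∈₂ with ∈-map⁻ (false ∷_) ε∈₂
...   | _ , ε′∈ , refl with ∈-prefixed⁻ n L ε′∈
...     | u , v , refl , len , v∈L = false ∷ u , v , refl , cong suc len , v∈L

∈-nonzeroBits⁺ : ∀ n (v : List Bool) → length v ≡ n → NonZeroBits v → v ∈ nonzeroBits n
∈-nonzeroBits⁺ (suc n) (true ∷ v)  len _ =
  ∈-++⁺ˡ (∈-map⁺ (true ∷_) (subst (_∈ prefixed n ([] ∷ [])) (++-identityʳ v) (∈-prefixed⁺ n v (suc-injective len) (here refl))))
∈-nonzeroBits⁺ (suc n) (false ∷ v) len (there v≢0) =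
  ∈-++⁺ʳ (map (true ∷_) (prefixed n ([] ∷ []))) (∈-map⁺ (false ∷_) (∈-nonzeroBits⁺ n v (suc-injective len) v≢0))

∈-nonzeroBits⁻ : ∀ n {v} → v ∈ nonzeroBits n → length v ≡ n × NonZeroBits v
∈-nonzeroBits⁻ (suc n) v∈ with ∈-++⁻ (map (true ∷_) (prefixed n ([] ∷ []))) v∈
... | inj₁ v∈₁ with ∈-map⁻ (true ∷_) v∈₁
...   | _ , v′∈ , refl with ∈-prefixed⁻ n ([] ∷ []) v′∈
...     | u , _ , refl , len , here refl = cong suc (trans (length-++ u) (trans (+-identityʳ _) len)) , here refl
∈-nonzeroBits⁻ (suc n) v∈ | inj₂ v∈₂ with ∈-map⁻ (false ∷_) v∈₂
...   | _ , v′∈ , refl with ∈-nonzeroBits⁻ n v′∈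
...     | len , v≢0 = cong suc len , there v≢0

private
  cons-unique : ∀ b {L : List (List Bool)} → Unique L → Unique (map (b ∷_) L)
  cons-unique b = Unique.map⁺ ∷-injectiveʳ

  true≢false-heads : ∀ (L K : List (List Bool)) {v} → ¬ (v ∈ map (true ∷_) L × v ∈ map (false ∷_) K)
  true≢false-heads L K (v∈L , v∈K) with ∈-map⁻ (true ∷_) v∈L | ∈-map⁻ (false ∷_) v∈K
  ... | _ , _ , refl | _ , _ , ()

prefixed-unique : ∀ n {L} → Unique L → Unique (prefixed n L)
prefixed-unique zero    L! = L!
prefixed-unique (suc n) {L} L! = Unique.++⁺ (cons-unique true (prefixed-unique n L!)) (cons-unique false (prefixed-unique n L!))
                                           (true≢false-heads (prefixed n L) (prefixed n L))

nonzeroBits-unique : ∀ n → Unique (nonzeroBits n)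
nonzeroBits-unique zero    = []
nonzeroBits-unique (suc n) = Unique.++⁺ (cons-unique true (prefixed-unique n ([] ∷ []))) (cons-unique false (nonzeroBits-unique n))
                                        (true≢false-heads (prefixed n ([] ∷ [])) (nonzeroBits n))

-- The coefficient vectors of the subgroups of index 2 of rank r (type A) and of rank r − 1 (type B).
typeA : ℕ → ℕ → List (List Bool)
typeA r₁ r₂ = map (_++ replicate r₂ false) (nonzeroBits r₁)

typeB : ℕ → ℕ → List (List Bool)
typeB r₁ r₂ = prefixed r₁ (nonzeroBits r₂)

¬nonzero⇒replicate : ∀ v → ¬ NonZeroBits v → v ≡ replicate (length v) false
¬nonzero⇒replicate []          _   = refl
¬nonzero⇒replicate (true ∷ v)  v≡0 = contradiction (here refl) v≡0
¬nonzero⇒replicate (false ∷ v) v≡0 = cong (false ∷_) (¬nonzero⇒replicate v (v≡0 ∘ there))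

typeA⊎typeB : ∀ r₁ r₂ ε → length ε ≡ r₁ + r₂ → NonZeroBits ε → ε ∈ typeA r₁ r₂ ⊎ ε ∈ typeB r₁ r₂
typeA⊎typeB r₁ r₂ ε len ε≢0 = split (any? (Bool._≟ true) w)
  where
  u = take r₁ ε
  w = drop r₁ ε
  |u| : length u ≡ r₁
  |u| = trans (length-take r₁ ε) (trans (cong (r₁ ⊓_) len) (m≤n⇒m⊓n≡m (m≤m+n r₁ r₂)))
  |w| : length w ≡ r₂
  |w| = trans (length-drop r₁ ε) (trans (cong (_∸ r₁) len) (m+n∸m≡n r₁ r₂))
  split : Dec (NonZeroBits w) → ε ∈ typeA r₁ r₂ ⊎ ε ∈ typeB r₁ r₂
  split (yes w≢0) = inj₂ (subst (_∈ typeB r₁ r₂) (take++drop≡id r₁ ε) (∈-prefixed⁺ r₁ u |u| (∈-nonzeroBits⁺ r₂ w |w| w≢0)))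
  split (no  w≡0) = inj₁ (subst (_∈ typeA r₁ r₂) u++0≡ε (∈-map⁺ (_++ replicate r₂ false) (∈-nonzeroBits⁺ r₁ u |u| u≢0)))
    where
    u≢0 : NonZeroBits u
    u≢0 = fromInj₁ (λ w≢0 → contradiction w≢0 w≡0) (Any.++⁻ u (subst NonZeroBits (sym (take++drop≡id r₁ ε)) ε≢0))
    u++0≡ε : u ++ replicate r₂ false ≡ ε
    u++0≡ε = begin
      u ++ replicate r₂ false         ≡⟨ cong (λ n → u ++ replicate n false) |w| ⟨
      u ++ replicate (length w) false ≡⟨ cong (u ++_) (¬nonzero⇒replicate w w≡0) ⟨
      u ++ w                          ≡⟨ take++drop≡id r₁ ε ⟩
      ε                               ∎

length-typeA : ∀ r₁ r₂ → length (typeA r₁ r₂) ≡ 2 ^ r₁ ∸ 1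
length-typeA r₁ r₂ = trans (length-map _ (nonzeroBits r₁)) (length-nonzeroBits r₁)

length-typeB : ∀ r₁ r₂ → length (typeB r₁ r₂) ≡ 2 ^ (r₁ + r₂) ∸ 2 ^ r₁
length-typeB r₁ r₂ = begin
  length (prefixed r₁ (nonzeroBits r₂)) ≡⟨ length-prefixed r₁ (nonzeroBits r₂) ⟩
  2 ^ r₁ * length (nonzeroBits r₂)      ≡⟨ cong (2 ^ r₁ *_) (length-nonzeroBits r₂) ⟩
  2 ^ r₁ * (2 ^ r₂ ∸ 1)                 ≡⟨ *-distribˡ-∸ (2 ^ r₁) (2 ^ r₂) 1 ⟩
  2 ^ r₁ * 2 ^ r₂ ∸ 2 ^ r₁ * 1          ≡⟨ cong₂ _∸_ (^-distribˡ-+-* 2 r₁ r₂) (sym (*-identityʳ (2 ^ r₁))) ⟨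
  2 ^ (r₁ + r₂) ∸ 2 ^ r₁                ∎

typeA-unique : ∀ r₁ r₂ → Unique (typeA r₁ r₂)
typeA-unique r₁ r₂ = Unique.map⁺ (++-cancelʳ (replicate r₂ false) _ _) (nonzeroBits-unique r₁)

typeB-unique : ∀ r₁ r₂ → Unique (typeB r₁ r₂)
typeB-unique r₁ r₂ = prefixed-unique r₁ (nonzeroBits-unique r₂)

∈-typeA⁻ : ∀ r₁ r₂ {ε} → ε ∈ typeA r₁ r₂ → ∃ λ v → ε ≡ v ++ replicate r₂ false × length v ≡ r₁ × NonZeroBits v
∈-typeA⁻ r₁ r₂ ε∈ with ∈-map⁻ _ ε∈
... | v , v∈ , refl = v , refl , ∈-nonzeroBits⁻ r₁ v∈

∈-typeB⁻ : ∀ r₁ r₂ {ε} → ε ∈ typeB r₁ r₂ → ∃₂ λ u w → ε ≡ u ++ w × length u ≡ r₁ × length w ≡ r₂ × NonZeroBits w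
∈-typeB⁻ r₁ r₂ ε∈ with ∈-prefixed⁻ r₁ (nonzeroBits r₂) ε∈
... | u , w , refl , |u| , w∈ = u , w , refl , |u| , ∈-nonzeroBits⁻ r₂ w∈

kernels-distinct : ∀ {ms} (ev : EvenModuli ms) {L : List (List Bool)} → Unique L →
  All (λ ε → length ε ≡ length ms) L → AllPairs (λ H K → ¬ (H ≐ K)) (map (kernel {ms}) L)
kernels-distinct ev {L} L! lengths = AllPairs.map⁺ (AllPairs.map distinct coefficients!)
  where
  coefficients! : AllPairs (λ v w → coefficients ev (χ v) ≢ coefficients ev (χ w)) L
  coefficients! = AllPairs.map⁻ (subst Unique (sym (map-id-local (All.map (λ {ε} → coefficients-χ ev ε) lengths))) L!)
  distinct : ∀ {v w} → coefficients ev (χ v) ≢ coefficients ev (χ w) → ¬ (kernel v ≐ kernel w)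
  distinct c≢ kv≐kw = c≢ (coefficients-cong ev (λ x → not-injective (kv≐kw x)))

exactly-kernels : ∀ {ms} (ev : EvenModuli ms) {P : Subset {ms} → Set} (L : List (List Bool)) {n} →
  length L ≡ n → Unique L → All (λ ε → length ε ≡ length ms) L →
  (∀ {ε} → ε ∈ L → P (kernel ε)) → (∀ H → P H → ∃ λ ε → ε ∈ L × H ≐ kernel ε) → Exactly n P
exactly-kernels ev L |L|≡n L! lengths sound complete =
  map kernel L , trans (length-map kernel L) |L|≡n , All.map⁺ (All.tabulate sound) , kernels-distinct ev L! lengths ,
  λ H PH → let (ε , ε∈L , H≐) = complete H PH in Any.map⁺ (Any.map (λ { refl → H≐ }) ε∈L)

n≢n∸1 : ∀ {n} → 1 ≤ n → n ≢ n ∸ 1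
n≢n∸1 {suc n} _ n+1≡n = <-irrefl (sym n+1≡n) (n<1+n n)

powers : ∀ {r₁} → Vec ℕ r₁ → List ℕ
powers α = map (2 ^_) (toList α)

length-powers : ∀ {r₁} (α : Vec ℕ r₁) → length (powers α) ≡ r₁
length-powers α = trans (length-map (2 ^_) (toList α)) (length-toList α)

length-moduli : ∀ {r₁} (α : Vec ℕ r₁) r₂ → length (moduli α r₂) ≡ r₁ + r₂
length-moduli α r₂ = trans (length-++ (powers α)) (cong₂ _+_ (length-powers α) (length-replicate r₂))

2^-even-4∣ : ∀ a → 2 ≤ a → Even⁺ (2 ^ a) × 4 ∣ 2 ^ a
2^-even-4∣ (suc zero)    (s≤s ())
2^-even-4∣ (suc (suc b)) _ =
  (pred (2 ^ suc b) , cong (2 *_) (sym (suc-pred (2 ^ suc b) {{m^n≢0 2 (suc b)}}))) ,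
  divides (2 ^ b) (trans (sym (*-assoc 2 2 (2 ^ b))) (*-comm 4 (2 ^ b)))

powers-even-4∣ : ∀ {r₁} (α : Vec ℕ r₁) → AllAtLeast2 α → All (λ m → Even⁺ m × 4 ∣ m) (powers α)
powers-even-4∣ []      α≥2 = []
powers-even-4∣ (a ∷ α) α≥2 = 2^-even-4∣ a (α≥2 Fin.zero) ∷ powers-even-4∣ α (α≥2 ∘ Fin.suc)

twos : ∀ r → All (_≡ 2) (replicate r 2)
twos zero    = []
twos (suc r) = refl ∷ twos r

moduli-even : ∀ {r₁} (α : Vec ℕ r₁) r₂ → AllAtLeast2 α → EvenModuli (moduli α r₂)
moduli-even α r₂ α≥2 = All.++⁺ (All.map proj₁ (powers-even-4∣ α α≥2)) (All.map (λ { refl → 0 , refl }) (twos r₂))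

module _ {r₁} (r₂ : ℕ) (α : Vec ℕ r₁) (α≥2 : AllAtLeast2 α) where
  private
    ms = moduli α r₂
    ev = moduli-even α r₂ α≥2
    4∣powers : All (4 ∣_) (powers α)
    4∣powers = All.map proj₂ (powers-even-4∣ α α≥2)

  PropertyA PropertyB : Subset {ms} → Set
  PropertyA H = IsSubgroup H × HasIndex2 H × HasRank H (r₁ + r₂)
  PropertyB H = IsSubgroup H × HasIndex2 H × HasRank H (r₁ + r₂ ∸ 1)

  typeA-kernel : ∀ {ε} → ε ∈ typeA r₁ r₂ → PropertyA (kernel ε)
  typeA-kernel ε∈ with ∈-typeA⁻ r₁ r₂ ε∈
  ... | v , refl , |v| , v≢0 =
    ker-isSubgroup ev (χ ε) (χ-isCharacter ev ε) , pivot-hasIndex2 ev p ,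
    subst (HasRank (kernel ε)) (length-moduli α r₂) (kernel-hasRank-length ev p 4∣ε)
    where
    ε = v ++ replicate r₂ false
    |v|′ = trans |v| (sym (length-powers α))
    p : Pivot true ms ε
    p = pivot-++ʳ (replicate r₂ 2) (replicate r₂ false) (nonzero⇒pivot 4∣powers |v|′ v≢0)
    4∣ε : DividesSelected 4 ε ms
    4∣ε = dividesSelected-++ (powers α) v |v|′ (dividesSelected-all 4∣powers v) (dividesSelected-none (replicate r₂ 2) r₂)

  typeB-kernel : ∀ {ε} → ε ∈ typeB r₁ r₂ → PropertyB (kernel ε)
  typeB-kernel ε∈ with ∈-typeB⁻ r₁ r₂ ε∈
  ... | u , w , refl , |u| , |w| , w≢0 =
    ker-isSubgroup ev (χ ε) (χ-isCharacter ev ε) , pivot-hasIndex2 ev p ,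
    subst (HasRank (kernel ε)) (cong (_∸ 1) (trans (suc-others p) (length-moduli α r₂))) (kernel-hasRank-others ev p)
    where
    ε = u ++ w
    p : Pivot false ms ε
    p = pivot-++ˡ (powers α) u (trans |u| (sym (length-powers α)))
                  (nonzero⇒pivot (twos r₂) (trans |w| (sym (length-replicate r₂))) w≢0)

  index2-typeA⊎typeB : ∀ {H} → IsSubgroup H → HasIndex2 H →
    ∃ λ ε → (ε ∈ typeA r₁ r₂ ⊎ ε ∈ typeB r₁ r₂) × H ≐ kernel ε
  index2-typeA⊎typeB {H} isSub index2 =
    ε , typeA⊎typeB r₁ r₂ ε (trans (coefficients-length ev (not ∘ H)) (length-moduli α r₂))
                           (index2-coefficients-nonzero ev isSub index2) ,
    index2-kernel ev isSub index2
    where ε = coefficients ev (not ∘ H)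

  typeA-complete : 1 ≤ r₁ + r₂ → ∀ H → PropertyA H → ∃ λ ε → ε ∈ typeA r₁ r₂ × H ≐ kernel ε
  typeA-complete r≥1 H (isSub , index2 , rank) with index2-typeA⊎typeB isSub index2
  ... | ε , inj₁ ε∈A , H≐ = ε , ε∈A , H≐
  ... | ε , inj₂ ε∈B , H≐ = contradiction (hasRank-unique rank (hasRank-≐ H≐ (proj₂ (proj₂ (typeB-kernel ε∈B))))) (n≢n∸1 r≥1)

  typeB-complete : 1 ≤ r₁ + r₂ → ∀ H → PropertyB H → ∃ λ ε → ε ∈ typeB r₁ r₂ × H ≐ kernel ε
  typeB-complete r≥1 H (isSub , index2 , rank) with index2-typeA⊎typeB isSub index2
  ... | ε , inj₂ ε∈B , H≐ = ε , ε∈B , H≐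
  ... | ε , inj₁ ε∈A , H≐ = contradiction (hasRank-unique (hasRank-≐ H≐ (proj₂ (proj₂ (typeA-kernel ε∈A)))) rank) (n≢n∸1 r≥1)

  typeA-lengths : All (λ ε → length ε ≡ length ms) (typeA r₁ r₂)
  typeA-lengths = All.tabulate λ ε∈ → case ∈-typeA⁻ r₁ r₂ ε∈ of λ where
    (v , refl , |v| , _) → trans (length-++ v) (trans (cong₂ _+_ |v| (length-replicate r₂)) (sym (length-moduli α r₂)))

  typeB-lengths : All (λ ε → length ε ≡ length ms) (typeB r₁ r₂)
  typeB-lengths = All.tabulate λ ε∈ → case ∈-typeB⁻ r₁ r₂ ε∈ of λ where
    (u , w , refl , |u| , |w| , _) → trans (length-++ u) (trans (cong₂ _+_ |u| |w|) (sym (length-moduli α r₂)))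

  exactly-typeA : 1 ≤ r₁ + r₂ → Exactly (2 ^ r₁ ∸ 1) PropertyA
  exactly-typeA r≥1 = exactly-kernels ev (typeA r₁ r₂) (length-typeA r₁ r₂) (typeA-unique r₁ r₂) typeA-lengths
                                      typeA-kernel (typeA-complete r≥1)

  exactly-typeB : 1 ≤ r₁ + r₂ → Exactly (2 ^ (r₁ + r₂) ∸ 2 ^ r₁) PropertyB
  exactly-typeB r≥1 = exactly-kernels ev (typeB r₁ r₂) (length-typeB r₁ r₂) (typeB-unique r₁ r₂) typeB-lengths
                                      typeB-kernel (typeB-complete r≥1)

lemma4p6 : (r₁ r₂ : ℕ) → 1 ≤ r₁ + r₂ → (α : Vec ℕ r₁) → NonIncreasing α → AllAtLeast2 α →
    Exactly {moduli α r₂} (2 ^ r₁ ∸ 1)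
      (λ H → IsSubgroup H × HasIndex2 H × HasRank H (r₁ + r₂))
    × Exactly {moduli α r₂} (2 ^ (r₁ + r₂) ∸ 2 ^ r₁)
      (λ H → IsSubgroup H × HasIndex2 H × HasRank H (r₁ + r₂ ∸ 1))
lemma4p6 r₁ r₂ r≥1 α _ α≥2 = exactly-typeA r₂ α α≥2 r≥1 , exactly-typeB r₂ α α≥2 r≥1
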